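{- Let $n=\prod_{i=1}^k p_i$ be a Carmichael number (with $p_1,\dots,p_k$ distinct odd primes) whose index $i(n)=\frac{n-1}{\lambda(n)}$ is odd, and let $h$ be the number of indices $i$ with $v_2(p_i-1)=v_2(\lambda(n))$. (1) If $1\le h<k$, then there are exactly $\frac{1}{2^{h+1}}\varphi(n)$ Euler liars in $\mathbb{Z}_n^*$, and all of them have Jacobi symbol $\left(\frac{a}{n}\right)=1$. (2) If $h=k$, then there are exactly $\frac{1}{2^{k-1}}\varphi(n)$ Euler liars in $\mathbb{Z}_n^*$, and among them the Jacobi symbol values $1$ and $-1$ occur equally often.
   Context: A Carmichael number is a composite integer $n$ with $a^{n-1}\equiv1\pmod n$ for all $a$ coprime to $n$; it is odd and squarefree. $\lambda(n)$ is the Carmichael lambda function (smallest positive $\ell$ with $a^\ell\equiv1\pmod n$ for all $a\in\mathbb{Z}_n^*$), equal to $\mathrm{lcm}(p_i-1)$ for squarefree $n$ and dividing $n-1$ for Carmichael $n$. $v_2(m)$ is the largest $N$ with $2^N\mid m$. For odd composite $n$, $a\in\mathbb{Z}_n^*$ is an Euler liar if $\left(\frac{a}{n}\right)\equiv a^{(n-1)/2}\pmod n$ (Jacobi symbol). -}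

module Defs where

open import Data.Nat using (_<?_; ℕ; zero; suc; _+_; _*_; _∸_; _^_; _≤_; _<_)
open import Data.Nat.Divisibility using (_∣_; _∣?_)
open import Data.Nat.Coprimality using (Coprime; coprime?)
open import Data.Nat.Primality using (Prime; prime?; Composite)
open import Data.Nat.DivMod using (_/_)
open import Data.Integer as ℤ using (ℤ; +_; -[1+_]; ∣_∣; _-_)
open import Data.List using (List; []; _∷_; length; filter; upTo; applyUpTo; foldr)
open import Data.Fin using (Fin; toℕ)
open import Data.Fin.Properties using (any?)
open import Data.Product using (Σ; ∃; ∃-syntax; _×_; _,_)
open import Relation.Nullary using (¬_; Dec; yes; no; _×-dec_; ¬?)
open import Relation.Unary using (Pred; Decidable)
open import Relation.Binary.PropositionalEquality using (_≡_)

countL : ∀ {p} {P : Pred ℕ p} → Decidable P → List ℕ → ℕ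
countL P? xs = length (filter P? xs)

CongZ : ℤ → ℤ → ℕ → Set
CongZ x y n = n ∣ ∣ x - y ∣

congZ? : (x y : ℤ) (n : ℕ) → Dec (CongZ x y n)
congZ? x y n = n ∣? ∣ x - y ∣

Cong : ℕ → ℕ → ℕ → Set
Cong x y n = CongZ (+ x) (+ y) n

Carmichael : ℕ → Set
Carmichael n = Composite n × (∀ a → Coprime a n → Cong (a ^ (n ∸ 1)) 1 n)

IsCarmichaelLambda : ℕ → ℕ → Set
IsCarmichaelLambda n ℓ =
  (0 < ℓ × (∀ a → Coprime a n → Cong (a ^ ℓ) 1 n)) ×
  (∀ m → 0 < m → (∀ a → Coprime a n → Cong (a ^ m) 1 n) → ℓ ≤ m)

IsV2 : ℕ → ℕ → Set
IsV2 m N = (2 ^ N) ∣ m × ¬ ((2 ^ (suc N)) ∣ m)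

isV2? : ∀ N → Decidable (λ m → IsV2 m N)
isV2? N m = ((2 ^ N) ∣? m) ×-dec ¬? ((2 ^ (suc N)) ∣? m)

OddIndex : ℕ → ℕ → Set
OddIndex n ℓ = ∃[ q ] (q * ℓ ≡ n ∸ 1 × Cong q 1 2)

QR? : (a p : ℕ) → Dec (∃[ x ] (Cong (toℕ {p} x * toℕ x) a p))
QR? a p = any? (λ x → congZ? (+ (toℕ x * toℕ x)) (+ a) p)

legendre : ℕ → ℕ → ℤ
legendre a p with p ∣? a
... | yes _ = + 0
... | no _ with QR? a p
...   | yes _ = + 1
...   | no _ = -[1+ 0 ]

-- multiplicity v_p(n) of p in n (for p ≥ 2, n ≥ 1): the number of e ∈ {1,…,n} with p^e ∣ n
mult : ℕ → ℕ → ℕ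
mult p n = countL (λ e → (p ^ e) ∣? n) (applyUpTo suc n)

jacobi : ℕ → ℕ → ℤ
jacobi a n = foldr ℤ._*_ (+ 1) (Data.List.map factor (upTo (suc n)))
  where
  factor : ℕ → ℤ
  factor p with prime? p
  ... | yes _ = legendre a p ℤ.^ mult p n
  ... | no _ = + 1
  open import Data.List using (map)

-- a ∈ ℤ_n^* (represented by 0 ≤ a < n, gcd(a,n) = 1)
Unit : ℕ → ℕ → Set
Unit n a = a < n × Coprime a n

EulerLiar : ℕ → ℕ → Set
EulerLiar n a = Unit n a × CongZ (jacobi a n) (+ (a ^ ((n ∸ 1) / 2))) n

eulerLiar? : ∀ n → Decidable (EulerLiar n)
eulerLiar? n a = (a <? n ×-dec coprime? a n) ×-dec (congZ? (jacobi a n) (+ (a ^ ((n ∸ 1) / 2))) n)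

φ : ℕ → ℕ
φ n = countL (λ a → coprime? a n) (upTo n)

numLiars : ℕ → ℕ
numLiars n = countL (eulerLiar? n) (upTo n)

numLiarsWithJacobi : ℕ → ℤ → ℕ
numLiarsWithJacobi n j = countL (λ a → eulerLiar? n a ×-dec (jacobi a n ℤ.≟ j)) (upTo n)

module Submission where

-- Write n - 1 = 2e and let a be a unit. For a prime p ∣ n, a^e ≡ ±1 (mod p); because the index is
-- odd, v₂(e) = N - 1, and comparing 2-adic valuations (via Fermat, Bézout and the fact that a
-- nonresidue b has b^((p-1)/2) ≢ 1) gives a^e ≡ (a/p) (mod p) when v₂(p - 1) = N and a^e ≡ 1 otherwise.
-- So a is an Euler liar iff its vector σ ∈ {±1}^k of Legendre symbols satisfies ∏σ = σᵢ at the h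
-- "balanced" primes and ∏σ = 1 at the others, and by the Chinese remainder theorem every σ comes
-- from exactly ∏ (pᵢ - 1)/2 units. If some prime is unbalanced, the admissible σ are those with
-- ∏σ = 1 and σᵢ = 1 at the balanced primes: 2^(k-h-1) of them. If all are balanced, σ must be
-- constant, and k is odd since (n - 1)/2^N is odd but ≡ k (mod 2); so σ = ±(1,…,1) both qualify.

open import Defs
open import Data.Bool as Bool using (Bool; true; false)
open import Data.Empty using (⊥-elim)
open import Data.Fin using (toℕ; fromℕ<)
open import Data.Fin.Properties using (toℕ<n; toℕ-fromℕ<)
open import Data.Integer as ℤ using (ℤ; +_; -[1+_]; _-_; -_; ∣_∣)
import Data.Integer.Properties as ℤ
open import Data.Integer.Divisibility.Signed as ℤ∣ using (∣ᵤ⇒∣; ∣⇒∣ᵤ)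
open import Data.Integer.Tactic.RingSolver as ℤ-Solver using ()
open import Data.List using (List; []; _∷_; length; filter; map; foldr; replicate; zipWith; upTo; applyUpTo; cartesianProduct; _++_)
open import Data.List.Properties
  using (filter-notAll; filter-++; filter-all; filter-none; filter-complete; filter-accept; filter-reject;
         length-map; length-++; length-upTo; length-applyUpTo; length-replicate; map-cong; map-cong-local; map-∘)
open import Data.List.Membership.Propositional using (_∈_; _∉_)
open import Data.List.Membership.Propositional.Properties
  using (∈-filter⁺; ∈-filter⁻; ∈-map⁺; ∈-map⁻; ∈-upTo⁺; ∈-upTo⁻; ∈-applyUpTo⁺; ∈-applyUpTo⁻;
         ∈-cartesianProduct⁺; ∈-cartesianProduct⁻; ∈-++⁻)
import Data.List.Membership.DecPropositional as DecMembership
open import Data.List.Relation.Binary.Subset.Propositional using (_⊆_)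
open import Data.List.Relation.Unary.All as All using (All; []; _∷_)
import Data.List.Relation.Unary.All.Properties as All
open import Data.List.Relation.Unary.Any as Any using (Any; here; there)
open import Data.List.Relation.Unary.Unique.Propositional using (Unique; []; _∷_)
import Data.List.Relation.Unary.Unique.Propositional.Properties as Unique
open import Data.Nat as ℕ using (ℕ; zero; suc; NonZero; _+_; _*_; _∸_; _^_; _≤_; _<_; z≤n; s≤s)
import Data.Nat.Properties as ℕ
open import Algebra.Properties.CommutativeSemigroup ℕ.*-commutativeSemigroup using (x∙yz≈y∙xz)
open import Data.Nat.Coprimality as Coprime using (Coprime; coprime?; coprime-divisor)
open import Data.Nat.Divisibility
  using (_∣_; _∣?_; divides; ∣-refl; ∣-trans; _∣0; 1∣_; ∣⇒≤; m∣m*n; n∣m*n; ∣n⇒∣m*n; ∣m∣n⇒∣m+n; ∣m+n∣m⇒∣n;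
         *-cancelˡ-∣; *-monoʳ-∣; m%n≡0⇒n∣m)
open import Data.Nat.DivMod using (_%_; _/_; m%n<n; m<n⇒m%n≡m; m≡m%n+[m/n]*n; %-remove-+ʳ; m*[n/m]≡n)
open import Data.Nat.GCD using (gcd; gcd-GCD; gcd[m,n]∣m; gcd[m,n]∣n; module Bézout)
open import Data.Nat.ListAction using (product)
open import Data.Nat.ListAction.Properties using (∈⇒∣product)
open import Data.Nat.Primality
  using (Prime; prime?; prime[2]; euclidsLemma; prime⇒nonZero; prime⇒nonTrivial; prime⇒irreducible;
         composite⇒nonTrivial; productOfPrimes≥1)
open import Data.Nat.Primality.Factorisation using (factorisationHasAllPrimeFactors)
open import Data.Nat.Tactic.RingSolver as ℕ-Solver using ()
open import Data.Product using (∃-syntax; _×_; _,_; proj₁; proj₂)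
open import Data.Product.Properties using (≡-dec)
open import Data.Sum as Sum using (_⊎_; inj₁; inj₂; [_,_]′)
open import Data.Unit using (⊤; tt)
open import Function using (_∘′_; id)
open import Level using (Level)
open import Relation.Binary.Bundles using (Setoid)
open import Relation.Binary.Definitions using (DecidableEquality)
open import Relation.Binary.PropositionalEquality
  using (_≡_; _≢_; refl; sym; trans; cong; cong₂; subst; subst₂; module ≡-Reasoning)
open import Relation.Binary.Structures using (IsEquivalence)
open import Relation.Nullary using (¬_; Dec; yes; no; does; _×-dec_; ¬?; map′)
open import Relation.Nullary.Decidable using (dec-true)
open import Relation.Unary using (Pred; Decidable)
open import Relation.Unary.Properties using (_∩?_; ∁?)

private
  variable
    a b ℓ₁ ℓ₂ : Level
    A B : Set a

-- Counting along lists

count : {P : Pred A ℓ₁} → Decidable P → List A → ℕ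
count P? xs = length (filter P? xs)

module _ {P : Pred A ℓ₁} {Q : Pred A ℓ₂} (P? : Decidable P) (Q? : Decidable Q) where

  count-cong : ∀ xs → (∀ {x} → x ∈ xs → P x → Q x) → (∀ {x} → x ∈ xs → Q x → P x) →
               count P? xs ≡ count Q? xs
  count-cong []       _   _   = refl
  count-cong (x ∷ xs) P⇒Q Q⇒P with P? x | Q? x
  ... | yes _  | yes _  = cong suc (count-cong xs (λ x∈ → P⇒Q (there x∈)) (λ x∈ → Q⇒P (there x∈)))
  ... | yes px | no ¬qx = ⊥-elim (¬qx (P⇒Q (here refl) px))
  ... | no ¬px | yes qx = ⊥-elim (¬px (Q⇒P (here refl) qx))
  ... | no _   | no _   = count-cong xs (λ x∈ → P⇒Q (there x∈)) (λ x∈ → Q⇒P (there x∈))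

  count-split : ∀ xs → count P? xs ≡ count (P? ∩? Q?) xs + count (P? ∩? ∁? Q?) xs
  count-split []       = refl
  count-split (x ∷ xs) with P? x | Q? x
  ... | yes _ | yes _ = cong suc (count-split xs)
  ... | yes _ | no _  = trans (cong suc (count-split xs)) (sym (ℕ.+-suc _ _))
  ... | no _  | yes _ = count-split xs
  ... | no _  | no _  = count-split xs

module _ {P : Pred A ℓ₁} (P? : Decidable P) where

  count-++ : ∀ xs ys → count P? (xs ++ ys) ≡ count P? xs + count P? ys
  count-++ xs ys = trans (cong length (filter-++ P? xs ys)) (length-++ (filter P? xs))

  count-map : ∀ (f : B → A) xs → count P? (map f xs) ≡ count (λ x → P? (f x)) xs
  count-map f []       = refl
  count-map f (x ∷ xs) with P? (f x)
  ... | yes _ = cong suc (count-map f xs)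
  ... | no _  = count-map f xs

  count-all : ∀ {xs} → All P xs → count P? xs ≡ length xs
  count-all Pxs = cong length (filter-all P? Pxs)

  count-none : ∀ {xs} → All (λ x → ¬ P x) xs → count P? xs ≡ 0
  count-none ¬Pxs = cong length (filter-none P? ¬Pxs)

  count≡length⇒All : ∀ xs → count P? xs ≡ length xs → All P xs
  count≡length⇒All xs eq = subst (All P) (filter-complete P? eq) (All.all-filter P? xs)

  count>0⇒∃ : ∀ xs → 0 < count P? xs → ∃[ x ] (x ∈ xs × P x)
  count>0⇒∃ (x ∷ xs) 0<count with P? x
  ... | yes Px = x , here refl , Px
  ... | no  _  = let y , y∈ , Py = count>0⇒∃ xs 0<count in y , there y∈ , Py

InjectiveOn : (A → B) → List A → Set _
InjectiveOn f xs = ∀ {x y} → x ∈ xs → y ∈ xs → f x ≡ f y → x ≡ y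

MapsTo : (A → B) → List A → List B → Set _
MapsTo f xs ys = ∀ {x} → x ∈ xs → f x ∈ ys

Covers : (A → B) → List A → List B → Set _
Covers f xs ys = ∀ {y} → y ∈ ys → ∃[ x ] (x ∈ xs × f x ≡ y)

map⁺-injectiveOn : ∀ (f : A → B) {xs} → InjectiveOn f xs → Unique xs → Unique (map f xs)
map⁺-injectiveOn f {[]}     inj []           = []
map⁺-injectiveOn f {x ∷ xs} inj (x∉xs ∷ uxs) =
  All.map⁺ (All.tabulate λ y∈ fx≡fy → All.lookup x∉xs y∈ (inj (here refl) (there y∈) fx≡fy))
  ∷ map⁺-injectiveOn f (λ x∈ y∈ → inj (there x∈) (there y∈)) uxs

module WithDecEq {A : Set a} (_≟_ : DecidableEquality A) where

  open DecMembership _≟_ using (_∈?_)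

  remove : A → List A → List A
  remove x = filter (λ y → ¬? (y ≟ x))

  length-remove : ∀ {x ys} → x ∈ ys → length (remove x ys) < length ys
  length-remove {x} {ys} x∈ys =
    filter-notAll (λ y → ¬? (y ≟ x)) ys (Any.map (λ x≡y y≢x → y≢x (sym x≡y)) x∈ys)

  ∈-remove⁺ : ∀ {x y ys} → y ∈ ys → y ≢ x → y ∈ remove x ys
  ∈-remove⁺ {x} = ∈-filter⁺ (λ y → ¬? (y ≟ x))

  ∈-remove⁻ : ∀ {x y ys} → y ∈ remove x ys → y ∈ ys × y ≢ x
  ∈-remove⁻ {x} = ∈-filter⁻ (λ y → ¬? (y ≟ x))

  private
    ⊆-remove : ∀ {x xs ys} → x ∉ xs → xs ⊆ ys → xs ⊆ remove x ys
    ⊆-remove x∉xs xs⊆ys z∈ = ∈-remove⁺ (xs⊆ys z∈) λ { refl → x∉xs z∈ }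

  Unique-⊆⇒length≤ : ∀ {xs ys} → Unique xs → xs ⊆ ys → length xs ≤ length ys
  Unique-⊆⇒length≤ {[]}     _             _     = z≤n
  Unique-⊆⇒length≤ {x ∷ xs} (x∉xs ∷ uxs) xs⊆ys = ℕ.≤-trans
    (s≤s (Unique-⊆⇒length≤ uxs (⊆-remove (λ x∈ → All.lookup x∉xs x∈ refl) (λ z∈ → xs⊆ys (there z∈)))))
    (length-remove (xs⊆ys (here refl)))

  Unique-⊆-length≥⇒⊇ : ∀ {xs ys} → Unique xs → xs ⊆ ys → length ys ≤ length xs → ys ⊆ xs
  Unique-⊆-length≥⇒⊇ {xs} {ys} uxs xs⊆ys ys≤xs {y} y∈ys with y ∈? xs
  ... | yes y∈xs = y∈xs
  ... | no  y∉xs = ⊥-elim (ℕ.<-irrefl refl (ℕ.<-≤-trans (ℕ.≤-<-trans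
          (Unique-⊆⇒length≤ uxs (⊆-remove y∉xs xs⊆ys)) (length-remove y∈ys)) ys≤xs))

  module _ {B : Set b} (f : B → A) {xs : List B} {ys : List A}
           (uxs : Unique xs) (inj : InjectiveOn f xs) (into : MapsTo f xs ys) where

    private
      map⊆ : map f xs ⊆ ys
      map⊆ z∈ with x , x∈ , refl ← ∈-map⁻ f z∈ = into x∈

    injectiveOn⇒covers : length ys ≤ length xs → Covers f xs ys
    injectiveOn⇒covers ys≤xs y∈ys
      with x , x∈ , refl ← ∈-map⁻ f (Unique-⊆-length≥⇒⊇ (map⁺-injectiveOn f inj uxs) map⊆
                                       (subst (length ys ≤_) (sym (length-map f xs)) ys≤xs) y∈ys)
      = x , x∈ , refl

    bijectiveOn⇒length≡ : Unique ys → Covers f xs ys → length xs ≡ length ys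
    bijectiveOn⇒length≡ uys onto = ℕ.≤-antisym
      (subst (_≤ length ys) (length-map f xs) (Unique-⊆⇒length≤ (map⁺-injectiveOn f inj uxs) map⊆))
      (subst (length ys ≤_) (length-map f xs) (Unique-⊆⇒length≤ uys ys⊆map))
      where
      ys⊆map : ys ⊆ map f xs
      ys⊆map y∈ with x , x∈ , refl ← onto y∈ = ∈-map⁺ f x∈


-- Congruences of integers

infix 4 _≡_[mod_]

record _≡_[mod_] (x y : ℤ) (n : ℕ) : Set where
  constructor mod-divides
  field
    divides-difference : + n ℤ∣.∣ x - y

open _≡_[mod_] public

module _ {n : ℕ} where

  ≡⇒≡[mod] : ∀ {x y} → x ≡ y → x ≡ y [mod n ]
  ≡⇒≡[mod] {x} refl = mod-divides (ℤ∣.divides (+ 0) (ℤ.+-inverseʳ x))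

  ≡[mod]-refl : ∀ {x} → x ≡ x [mod n ]
  ≡[mod]-refl = ≡⇒≡[mod] refl

  ≡[mod]-sym : ∀ {x y} → x ≡ y [mod n ] → y ≡ x [mod n ]
  ≡[mod]-sym {x} {y} (mod-divides n∣x-y) =
    mod-divides (subst (_ ℤ∣.∣_) (negate x y) (ℤ∣.∣m⇒∣-m n∣x-y))
    where
    negate : ∀ x y → - (x - y) ≡ y - x
    negate = ℤ-Solver.solve-∀

  ≡[mod]-trans : ∀ {x y z} → x ≡ y [mod n ] → y ≡ z [mod n ] → x ≡ z [mod n ]
  ≡[mod]-trans {x} {y} {z} (mod-divides n∣x-y) (mod-divides n∣y-z) =
    mod-divides (subst (_ ℤ∣.∣_) (telescope x y z) (ℤ∣.∣m∣n⇒∣m+n n∣x-y n∣y-z))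
    where
    telescope : ∀ x y z → (x - y) ℤ.+ (y - z) ≡ x - z
    telescope = ℤ-Solver.solve-∀

  ≡[mod]-isEquivalence : IsEquivalence (λ x y → x ≡ y [mod n ])
  ≡[mod]-isEquivalence = record { refl = ≡[mod]-refl ; sym = ≡[mod]-sym ; trans = ≡[mod]-trans }

  +-cong-mod : ∀ {x x′ y y′} → x ≡ x′ [mod n ] → y ≡ y′ [mod n ] → x ℤ.+ y ≡ x′ ℤ.+ y′ [mod n ]
  +-cong-mod {x} {x′} {y} {y′} (mod-divides n∣x-x′) (mod-divides n∣y-y′) =
    mod-divides (subst (_ ℤ∣.∣_) (regroup x x′ y y′) (ℤ∣.∣m∣n⇒∣m+n n∣x-x′ n∣y-y′))
    where
    regroup : ∀ x x′ y y′ → (x - x′) ℤ.+ (y - y′) ≡ (x ℤ.+ y) - (x′ ℤ.+ y′)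
    regroup = ℤ-Solver.solve-∀

  *-cong-mod : ∀ {x x′ y y′} → x ≡ x′ [mod n ] → y ≡ y′ [mod n ] → x ℤ.* y ≡ x′ ℤ.* y′ [mod n ]
  *-cong-mod {x} {x′} {y} {y′} (mod-divides n∣x-x′) (mod-divides n∣y-y′) =
    mod-divides (subst (_ ℤ∣.∣_) (regroup x x′ y y′) (ℤ∣.∣m∣n⇒∣m+n (ℤ∣.∣n⇒∣m*n x n∣y-y′) (ℤ∣.∣m⇒∣m*n y′ n∣x-x′)))
    where
    regroup : ∀ x x′ y y′ → x ℤ.* (y - y′) ℤ.+ (x - x′) ℤ.* y′ ≡ x ℤ.* y - x′ ℤ.* y′
    regroup = ℤ-Solver.solve-∀

  ^-cong-mod : ∀ {x y} k → x ≡ y [mod n ] → x ℤ.^ k ≡ y ℤ.^ k [mod n ]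
  ^-cong-mod zero    _   = ≡[mod]-refl
  ^-cong-mod (suc k) x≡y = *-cong-mod x≡y (^-cong-mod k x≡y)

  ≡0[mod]⇒∣ : ∀ {x} → x ≡ + 0 [mod n ] → + n ℤ∣.∣ x
  ≡0[mod]⇒∣ {x} (mod-divides n∣x-0) = subst (_ ℤ∣.∣_) (ℤ.+-identityʳ x) n∣x-0

  ∣⇒≡0[mod] : ∀ {x} → + n ℤ∣.∣ x → x ≡ + 0 [mod n ]
  ∣⇒≡0[mod] {x} n∣x = mod-divides (subst (_ ℤ∣.∣_) (sym (ℤ.+-identityʳ x)) n∣x)

  CongZ⇒≡[mod] : ∀ {x y} → CongZ x y n → x ≡ y [mod n ]
  CongZ⇒≡[mod] n∣∣x-y∣ = mod-divides (∣ᵤ⇒∣ n∣∣x-y∣)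

  ≡[mod]⇒CongZ : ∀ {x y} → x ≡ y [mod n ] → CongZ x y n
  ≡[mod]⇒CongZ (mod-divides n∣x-y) = ∣⇒∣ᵤ n∣x-y

≡[mod]-setoid : ℕ → Setoid _ _
≡[mod]-setoid n = record { isEquivalence = ≡[mod]-isEquivalence {n} }

module ≡[mod]-Reasoning (n : ℕ) where
  open import Relation.Binary.Reasoning.Setoid (≡[mod]-setoid n) public

≡[mod]-divisor : ∀ {d m x y} → d ∣ m → x ≡ y [mod m ] → x ≡ y [mod d ]
≡[mod]-divisor d∣m (mod-divides m∣x-y) = mod-divides (ℤ∣.∣-trans (∣ᵤ⇒∣ d∣m) m∣x-y)

pos-^ : ∀ a k → + (a ^ k) ≡ (+ a) ℤ.^ k
pos-^ a zero    = refl
pos-^ a (suc k) = trans (ℤ.pos-* a (a ^ k)) (cong ((+ a) ℤ.*_) (pos-^ a k))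

^-distribʳ-* : ∀ x y k → (x ℤ.* y) ℤ.^ k ≡ x ℤ.^ k ℤ.* y ℤ.^ k
^-distribʳ-* x y zero    = refl
^-distribʳ-* x y (suc k) = trans (cong ((x ℤ.* y) ℤ.*_) (^-distribʳ-* x y k)) (interchange x y (x ℤ.^ k) (y ℤ.^ k))
  where
  interchange : ∀ x y a b → x ℤ.* y ℤ.* (a ℤ.* b) ≡ x ℤ.* a ℤ.* (y ℤ.* b)
  interchange = ℤ-Solver.solve-∀

module _ {n : ℕ} .{{_ : NonZero n}} where

  %-≡[mod] : ∀ a → + (a % n) ≡ + a [mod n ]
  %-≡[mod] a = ≡[mod]-sym (mod-divides (ℤ∣.divides (+ (a / n)) (begin
    + a - + (a % n)                         ≡⟨ cong (λ z → + z - + (a % n)) (m≡m%n+[m/n]*n a n) ⟩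
    + (a % n + a / n * n) - + (a % n)   ≡⟨ cong (_- + (a % n)) (trans (ℤ.pos-+ (a % n) _) (cong (λ z → + (a % n) ℤ.+ z) (ℤ.pos-* (a / n) n))) ⟩
    + (a % n) ℤ.+ + (a / n) ℤ.* + n - + (a % n) ≡⟨ cancel (+ (a % n)) (+ (a / n)) (+ n) ⟩
    + (a / n) ℤ.* + n                       ∎)))
    where
    open ≡-Reasoning
    cancel : ∀ r q n → r ℤ.+ q ℤ.* n - r ≡ q ℤ.* n
    cancel = ℤ-Solver.solve-∀

  private
    %-≡-of-≤ : ∀ {a b} → a ≤ b → + b ≡ + a [mod n ] → b % n ≡ a % n
    %-≡-of-≤ {a} {b} a≤b (mod-divides n∣b-a) = trans (cong (_% n) (sym (ℕ.m+[n∸m]≡n a≤b)))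
      (%-remove-+ʳ a (subst (n ∣_) (cong ∣_∣ (trans (ℤ.[+m]-[+n]≡m⊖n b a) (ℤ.⊖-≥ a≤b))) (∣⇒∣ᵤ n∣b-a)))

  ≡[mod]⇒%≡ : ∀ {a b} → + a ≡ + b [mod n ] → a % n ≡ b % n
  ≡[mod]⇒%≡ {a} {b} a≡b with ℕ.≤-total a b
  ... | inj₁ a≤b = sym (%-≡-of-≤ a≤b (≡[mod]-sym a≡b))
  ... | inj₂ b≤a = %-≡-of-≤ b≤a a≡b

  %≡⇒≡[mod] : ∀ {a b} → a % n ≡ b % n → + a ≡ + b [mod n ]
  %≡⇒≡[mod] {a} {b} a%n≡b%n =
    ≡[mod]-trans (≡[mod]-sym (%-≡[mod] a)) (≡[mod]-trans (≡⇒≡[mod] (cong +_ a%n≡b%n)) (%-≡[mod] b))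

  ≡[mod]-<⇒≡ : ∀ {a b} → a < n → b < n → + a ≡ + b [mod n ] → a ≡ b
  ≡[mod]-<⇒≡ a<n b<n a≡b = trans (sym (m<n⇒m%n≡m a<n)) (trans (≡[mod]⇒%≡ a≡b) (m<n⇒m%n≡m b<n))

∣-resp-≡[mod] : ∀ {d m a b} → d ∣ m → + a ≡ + b [mod m ] → d ∣ a → d ∣ b
∣-resp-≡[mod] d∣m a≡b d∣a =
  ∣⇒∣ᵤ (≡0[mod]⇒∣ (≡[mod]-trans (≡[mod]-sym (≡[mod]-divisor d∣m a≡b)) (∣⇒≡0[mod] (∣ᵤ⇒∣ d∣a))))

coprime-resp-≡[mod] : ∀ {m a b} → + a ≡ + b [mod m ] → Coprime a m → Coprime b m
coprime-resp-≡[mod] a≡b a⊥m (d∣b , d∣m) = a⊥m (∣-resp-≡[mod] d∣m (≡[mod]-sym a≡b) d∣b , d∣m)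

^-≡1-∣ : ∀ {n x d e} → d ∣ e → x ℤ.^ d ≡ + 1 [mod n ] → x ℤ.^ e ≡ + 1 [mod n ]
^-≡1-∣ {n} {x} {d} (divides k refl) x^d≡1 = begin
  x ℤ.^ (k * d)       ≡⟨ cong (x ℤ.^_) (ℕ.*-comm k d) ⟩
  x ℤ.^ (d * k)       ≡⟨ ℤ.^-*-assoc x d k ⟨
  (x ℤ.^ d) ℤ.^ k       ≈⟨ ^-cong-mod k x^d≡1 ⟩
  (+ 1) ℤ.^ k           ≡⟨ ℤ.^-zeroˡ k ⟩
  + 1                   ∎
  where open ≡[mod]-Reasoning n

private
  ^-≡1-cancel : ∀ {n} x g f → x ℤ.^ f ≡ + 1 [mod n ] → x ℤ.^ (g + f) ≡ + 1 [mod n ] → x ℤ.^ g ≡ + 1 [mod n ]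
  ^-≡1-cancel {n} x g f x^f≡1 x^g+f≡1 = begin
    x ℤ.^ g                  ≡⟨ ℤ.*-identityʳ (x ℤ.^ g) ⟨
    x ℤ.^ g ℤ.* + 1          ≈⟨ *-cong-mod (≡[mod]-refl {x = x ℤ.^ g}) (≡[mod]-sym x^f≡1) ⟩
    x ℤ.^ g ℤ.* x ℤ.^ f      ≡⟨ ℤ.^-distribˡ-+-* x g f ⟨
    x ℤ.^ (g + f)          ≈⟨ x^g+f≡1 ⟩
    + 1                      ∎
    where open ≡[mod]-Reasoning n

^-≡1-gcd : ∀ {n} x d e → x ℤ.^ d ≡ + 1 [mod n ] → x ℤ.^ e ≡ + 1 [mod n ] → x ℤ.^ gcd d e ≡ + 1 [mod n ]
^-≡1-gcd x d e x^d≡1 x^e≡1 with Bézout.identity (gcd-GCD d e)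
... | Bézout.+- k l gcd+le≡kd = ^-≡1-cancel x (gcd d e) (l * e) (^-≡1-∣ (n∣m*n l) x^e≡1)
  (≡[mod]-trans (≡⇒≡[mod] (cong (x ℤ.^_) gcd+le≡kd)) (^-≡1-∣ (n∣m*n k) x^d≡1))
... | Bézout.-+ k l gcd+kd≡le = ^-≡1-cancel x (gcd d e) (k * d) (^-≡1-∣ (n∣m*n k) x^d≡1)
  (≡[mod]-trans (≡⇒≡[mod] (cong (x ℤ.^_) gcd+kd≡le)) (^-≡1-∣ (n∣m*n l) x^e≡1))

-- Prime moduli: Euclid, roots of polynomials, Fermat

private
  *-distribʳ-- : ∀ x y z → x ℤ.* z - y ℤ.* z ≡ (x - y) ℤ.* z
  *-distribʳ-- = ℤ-Solver.solve-∀

  x²-1≡[x-1][x+1] : ∀ x → x ℤ.* x - + 1 ≡ (x - + 1) ℤ.* (x - -[1+ 0 ])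
  x²-1≡[x-1][x+1] = ℤ-Solver.solve-∀

prod : List ℤ → ℤ
prod = foldr ℤ._*_ (+ 1)

prod-map-scale : ∀ c (f : A → ℤ) xs → prod (map (λ x → c ℤ.* f x) xs) ≡ c ℤ.^ length xs ℤ.* prod (map f xs)
prod-map-scale c f []       = refl
prod-map-scale c f (x ∷ xs) =
  trans (cong (c ℤ.* f x ℤ.*_) (prod-map-scale c f xs)) (interchange c (f x) (c ℤ.^ length xs) (prod (map f xs)))
  where
  interchange : ∀ c a b d → c ℤ.* a ℤ.* (b ℤ.* d) ≡ c ℤ.* b ℤ.* (a ℤ.* d)
  interchange = ℤ-Solver.solve-∀

prod-cong-mod : ∀ {n} {f g : A → ℤ} xs → All (λ x → f x ≡ g x [mod n ]) xs →
                prod (map f xs) ≡ prod (map g xs) [mod n ]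
prod-cong-mod []       []          = ≡[mod]-refl
prod-cong-mod (x ∷ xs) (fx≡gx ∷ e) = *-cong-mod fx≡gx (prod-cong-mod xs e)

module _ {A : Set a} (_≟_ : DecidableEquality A) (f : A → ℤ) where
  open WithDecEq _≟_
  open DecMembership _≟_ using (_∈?_)

  prod-remove : ∀ {x xs} → Unique xs → x ∈ xs → prod (map f xs) ≡ f x ℤ.* prod (map f (remove x xs))
  prod-remove {x} {y ∷ xs} (y∉xs ∷ _) (here refl) =
    cong (λ ys → f x ℤ.* prod (map f ys))
         (sym (trans (filter-reject (λ z → ¬? (z ≟ x)) (λ x≢x → x≢x refl))
                     (filter-all (λ z → ¬? (z ≟ x)) (All.map (λ x≢z z≡x → x≢z (sym z≡x)) y∉xs))))
  prod-remove {x} {y ∷ xs} (y∉xs ∷ uxs) (there x∈xs) = begin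
    f y ℤ.* prod (map f xs)                              ≡⟨ cong (f y ℤ.*_) (prod-remove uxs x∈xs) ⟩
    f y ℤ.* (f x ℤ.* prod (map f (remove x xs)))         ≡⟨ swap (f y) (f x) _ ⟩
    f x ℤ.* (f y ℤ.* prod (map f (remove x xs)))         ≡⟨ cong (λ ys → f x ℤ.* prod (map f ys)) (sym (filter-accept (λ z → ¬? (z ≟ x)) y≢x)) ⟩
    f x ℤ.* prod (map f (remove x (y ∷ xs)))             ∎
    where
    open ≡-Reasoning
    swap : ∀ a b c → a ℤ.* (b ℤ.* c) ≡ b ℤ.* (a ℤ.* c)
    swap = ℤ-Solver.solve-∀
    y≢x : y ≢ x
    y≢x = All.lookup y∉xs x∈xs

  prod-map-⊆ : ∀ {xs ys} → Unique xs → Unique ys → ys ⊆ xs →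
               (∀ {x} → x ∈ xs → x ∉ ys → f x ≡ + 1) → prod (map f xs) ≡ prod (map f ys)
  prod-map-⊆ {[]}     {[]}    _ _ _ _ = refl
  prod-map-⊆ {[]}     {_ ∷ _} _ _ ys⊆xs _ with () ← ys⊆xs (here refl)
  prod-map-⊆ {x ∷ xs} {ys} (x∉xs ∷ uxs) uys ys⊆xs rest≡1 with x ∈? ys
  ... | yes x∈ys = trans (cong (f x ℤ.*_) (prod-map-⊆ uxs (Unique.filter⁺ _ uys) ys-x⊆xs rest≡1′))
                         (sym (prod-remove uys x∈ys))
    where
    ys-x⊆xs : remove x ys ⊆ xs
    ys-x⊆xs z∈ with z∈ys , z≢x ← ∈-remove⁻ z∈ with ys⊆xs z∈ys
    ... | here z≡x = ⊥-elim (z≢x z≡x)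
    ... | there z∈xs = z∈xs
    rest≡1′ : ∀ {z} → z ∈ xs → z ∉ remove x ys → f z ≡ + 1
    rest≡1′ z∈xs z∉ = rest≡1 (there z∈xs) λ z∈ys → z∉ (∈-remove⁺ z∈ys λ { refl → All.lookup x∉xs z∈xs refl })
  ... | no x∉ys = trans (cong (ℤ._* prod (map f xs)) (rest≡1 (here refl) x∉ys))
                        (trans (ℤ.*-identityˡ _) (prod-map-⊆ uxs uys ys⊆xs′ (λ z∈ → rest≡1 (there z∈))))
    where
    ys⊆xs′ : ys ⊆ xs
    ys⊆xs′ z∈ with ys⊆xs z∈
    ... | here refl  = ⊥-elim (x∉ys z∈)
    ... | there z∈xs = z∈xs

module _ {p : ℕ} (prime : Prime p) where

  private
    instance
      p≢0 : NonZero p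
      p≢0 = prime⇒nonZero prime

  prime∤1 : ¬ (+ p ℤ∣.∣ + 1)
  prime∤1 p∣1 = ℕ.<⇒≱ (ℕ.nonTrivial⇒n>1 p {{prime⇒nonTrivial prime}}) (∣⇒≤ (∣⇒∣ᵤ p∣1))

  prime∤nonzero< : ∀ {x} → 0 < x → x < p → ¬ (p ∣ x)
  prime∤nonzero< {suc _} _ x<p p∣x = ℕ.<⇒≱ x<p (∣⇒≤ p∣x)

  euclidsLemmaℤ : ∀ x y → + p ℤ∣.∣ x ℤ.* y → + p ℤ∣.∣ x ⊎ + p ℤ∣.∣ y
  euclidsLemmaℤ x y p∣xy with euclidsLemma ∣ x ∣ ∣ y ∣ prime (subst (p ∣_) (ℤ.abs-* x y) (∣⇒∣ᵤ p∣xy))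
  ... | inj₁ p∣x = inj₁ (∣ᵤ⇒∣ p∣x)
  ... | inj₂ p∣y = inj₂ (∣ᵤ⇒∣ p∣y)

  prime∣prod⇒∣any : ∀ xs → + p ℤ∣.∣ prod xs → Any (+ p ℤ∣.∣_) xs
  prime∣prod⇒∣any []       p∣1 = ⊥-elim (prime∤1 p∣1)
  prime∣prod⇒∣any (x ∷ xs) p∣x*xs with euclidsLemmaℤ x (prod xs) p∣x*xs
  ... | inj₁ p∣x  = here p∣x
  ... | inj₂ p∣xs = there (prime∣prod⇒∣any xs p∣xs)

  *-cancelʳ-mod : ∀ {x y z} → ¬ (+ p ℤ∣.∣ z) → x ℤ.* z ≡ y ℤ.* z [mod p ] → x ≡ y [mod p ]
  *-cancelʳ-mod {x} {y} {z} p∤z (mod-divides p∣xz-yz) =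
    [ mod-divides , ⊥-elim ∘′ p∤z ]′ (euclidsLemmaℤ (x - y) z (subst (_ ℤ∣.∣_) (*-distribʳ-- x y z) p∣xz-yz))

  square≡1⇒±1 : ∀ x → x ℤ.* x ≡ + 1 [mod p ] → x ≡ + 1 [mod p ] ⊎ x ≡ -[1+ 0 ] [mod p ]
  square≡1⇒±1 x (mod-divides p∣x²-1) =
    Sum.map mod-divides mod-divides (euclidsLemmaℤ (x - + 1) (x - -[1+ 0 ]) (subst (_ ℤ∣.∣_) (x²-1≡[x-1][x+1] x) p∣x²-1))

1≢-1[mod] : ∀ {n} → 3 ≤ n → ¬ (+ 1 ≡ -[1+ 0 ] [mod n ])
1≢-1[mod] 3≤n (mod-divides n∣2) = ℕ.<⇒≱ (ℕ.<-≤-trans (ℕ.n<1+n 2) 3≤n) (∣⇒≤ (∣⇒∣ᵤ n∣2))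

-- c₀ ∷ ⋯ ∷ c_{d-1} stands for the monic polynomial c₀ + c₁x + ⋯ + c_{d-1}x^{d-1} + x^d.
evalMonic : List ℤ → ℤ → ℤ
evalMonic []       x = + 1
evalMonic (c ∷ cs) x = c ℤ.+ x ℤ.* evalMonic cs x

divideByLinear : List ℤ → ℤ → List ℤ
divideByLinear []           r = []
divideByLinear (c ∷ [])     r = []
divideByLinear (c ∷ c′ ∷ cs) r = evalMonic (c′ ∷ cs) r ∷ divideByLinear (c′ ∷ cs) r

length-divideByLinear : ∀ c cs r → length (divideByLinear (c ∷ cs) r) ≡ length cs
length-divideByLinear c []        r = refl
length-divideByLinear c (c′ ∷ cs) r = cong suc (length-divideByLinear c′ cs r)

evalMonic-divideByLinear : ∀ c cs r x →
  evalMonic (c ∷ cs) x ≡ (x - r) ℤ.* evalMonic (divideByLinear (c ∷ cs) r) x ℤ.+ evalMonic (c ∷ cs) r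
evalMonic-divideByLinear c []        r x = linear c r x
  where
  linear : ∀ c r x → c ℤ.+ x ℤ.* + 1 ≡ (x - r) ℤ.* + 1 ℤ.+ (c ℤ.+ r ℤ.* + 1)
  linear = ℤ-Solver.solve-∀
evalMonic-divideByLinear c (c′ ∷ cs) r x =
  trans (cong (λ z → c ℤ.+ x ℤ.* z) (evalMonic-divideByLinear c′ cs r x))
        (horner c x r (evalMonic (divideByLinear (c′ ∷ cs) r) x) (evalMonic (c′ ∷ cs) r))
  where
  horner : ∀ c x r q g → c ℤ.+ x ℤ.* ((x - r) ℤ.* q ℤ.+ g) ≡ (x - r) ℤ.* (g ℤ.+ x ℤ.* q) ℤ.+ (c ℤ.+ r ℤ.* g)
  horner = ℤ-Solver.solve-∀

module _ {p : ℕ} (prime : Prime p) where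

  private
    instance
      p≢0 : NonZero p
      p≢0 = prime⇒nonZero prime

    factorRoot : ∀ c cs r s → evalMonic (c ∷ cs) r ≡ + 0 [mod p ] → evalMonic (c ∷ cs) s ≡ + 0 [mod p ] →
                 (s - r) ℤ.* evalMonic (divideByLinear (c ∷ cs) r) s ≡ + 0 [mod p ]
    factorRoot c cs r s root froot = begin
      (s - r) ℤ.* Q                          ≡⟨ ℤ.+-identityʳ ((s - r) ℤ.* Q) ⟨
      (s - r) ℤ.* Q ℤ.+ + 0                  ≈⟨ +-cong-mod (≡[mod]-refl {x = (s - r) ℤ.* Q}) (≡[mod]-sym root) ⟩
      (s - r) ℤ.* Q ℤ.+ evalMonic (c ∷ cs) r ≡⟨ evalMonic-divideByLinear c cs r s ⟨
      evalMonic (c ∷ cs) s                   ≈⟨ froot ⟩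
      + 0                                    ∎
      where
      open ≡[mod]-Reasoning p
      Q = evalMonic (divideByLinear (c ∷ cs) r) s

  rootsBound : ∀ cs rs → Unique rs → All (_< p) rs → All (λ r → evalMonic cs (+ r) ≡ + 0 [mod p ]) rs →
               length rs ≤ length cs
  rootsBound cs       []       _ _ _ = z≤n
  rootsBound []       (r ∷ rs) _ _ (1≡0 ∷ _) = ⊥-elim (prime∤1 prime (≡0[mod]⇒∣ 1≡0))
  rootsBound (c ∷ cs) (r ∷ rs) (r∉rs ∷ urs) (r<p ∷ rs<p) (root ∷ roots) =
    s≤s (subst (length rs ≤_) (length-divideByLinear c cs (+ r))
               (rootsBound q rs urs rs<p (All.tabulate λ {s} s∈ →
                  quotientRoot (All.lookup rs<p s∈) (All.lookup r∉rs s∈)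
                    (euclidsLemmaℤ prime (+ s - + r) (evalMonic q (+ s))
                      (≡0[mod]⇒∣ (factorRoot c cs (+ r) (+ s) root (All.lookup roots s∈)))))))
    where
    q = divideByLinear (c ∷ cs) (+ r)
    quotientRoot : ∀ {s} → s < p → r ≢ s → + p ℤ∣.∣ + s - + r ⊎ + p ℤ∣.∣ evalMonic q (+ s) →
                   evalMonic q (+ s) ≡ + 0 [mod p ]
    quotientRoot s<p r≢s (inj₁ p∣s-r) = ⊥-elim (r≢s (sym (≡[mod]-<⇒≡ s<p r<p (mod-divides p∣s-r))))
    quotientRoot s<p r≢s (inj₂ p∣q)   = ∣⇒≡0[mod] p∣q

  powRootsBound : ∀ d rs → Unique rs → All (_< p) rs → All (λ r → (+ r) ℤ.^ suc d ≡ + 1 [mod p ]) rs →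
                  length rs ≤ suc d
  powRootsBound d rs urs rs<p roots =
    subst (length rs ≤_) (cong suc (length-replicate d))
          (rootsBound (-[1+ 0 ] ∷ replicate d (+ 0)) rs urs rs<p (All.map root roots))
    where
    evalMonic-zeros : ∀ d x → evalMonic (replicate d (+ 0)) x ≡ x ℤ.^ d
    evalMonic-zeros zero    x = refl
    evalMonic-zeros (suc d) x = trans (ℤ.+-identityˡ _) (cong (x ℤ.*_) (evalMonic-zeros d x))
    root : ∀ {r} → (+ r) ℤ.^ suc d ≡ + 1 [mod p ] → evalMonic (-[1+ 0 ] ∷ replicate d (+ 0)) (+ r) ≡ + 0 [mod p ]
    root {r} r^d+1≡1 = begin
      -[1+ 0 ] ℤ.+ + r ℤ.* evalMonic (replicate d (+ 0)) (+ r) ≡⟨ cong (λ z → -[1+ 0 ] ℤ.+ + r ℤ.* z) (evalMonic-zeros d (+ r)) ⟩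
      -[1+ 0 ] ℤ.+ (+ r) ℤ.^ suc d                              ≈⟨ +-cong-mod (≡[mod]-refl {x = -[1+ 0 ]}) r^d+1≡1 ⟩
      + 0                                                       ∎
      where open ≡[mod]-Reasoning p


module _ {p : ℕ} (prime : Prime p) where

  private
    instance
      p≢0 : NonZero p
      p≢0 = prime⇒nonZero prime

  nonzeroResidues : List ℕ
  nonzeroResidues = applyUpTo suc (p ∸ 1)

  ∈-nonzeroResidues⁻ : ∀ {x} → x ∈ nonzeroResidues → 0 < x × x < p
  ∈-nonzeroResidues⁻ x∈ with i , i<p-1 , refl ← ∈-applyUpTo⁻ suc x∈ =
    s≤s z≤n , ℕ.<-≤-trans (s≤s i<p-1) (ℕ.≤-reflexive (ℕ.suc-pred p))

  ∈-nonzeroResidues⁺ : ∀ {x} → 0 < x → x < p → x ∈ nonzeroResidues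
  ∈-nonzeroResidues⁺ {suc i} _ x<p = ∈-applyUpTo⁺ suc (ℕ.∸-monoˡ-≤ 1 x<p)

  nonzeroResidues-unique : Unique nonzeroResidues
  nonzeroResidues-unique = Unique.applyUpTo⁺₁ suc (p ∸ 1) (λ i<j _ → ℕ.<⇒≢ i<j ∘′ ℕ.suc-injective)

  length-nonzeroResidues : length nonzeroResidues ≡ p ∸ 1
  length-nonzeroResidues = length-applyUpTo suc (p ∸ 1)

  prime∤nonzeroResidue : ∀ {x} → x ∈ nonzeroResidues → ¬ (p ∣ x)
  prime∤nonzeroResidue x∈ = let 0<x , x<p = ∈-nonzeroResidues⁻ x∈ in prime∤nonzero< prime 0<x x<p

  prime∤prod-nonzeroResidues : ¬ (+ p ℤ∣.∣ prod (map +_ nonzeroResidues))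
  prime∤prod-nonzeroResidues p∣∏ =
    All.All¬⇒¬Any (All.map⁺ (All.tabulate λ x∈ p∣x → prime∤nonzeroResidue x∈ (∣⇒∣ᵤ p∣x)))
              (prime∣prod⇒∣any prime (map +_ nonzeroResidues) p∣∏)

  *-%-injective : ∀ {a x y} → ¬ (p ∣ a) → x < p → y < p → a * x % p ≡ a * y % p → x ≡ y
  *-%-injective {a} {x} {y} p∤a x<p y<p ax%p≡ay%p =
    ≡[mod]-<⇒≡ x<p y<p (*-cancelʳ-mod prime (λ p∣a → p∤a (∣⇒∣ᵤ p∣a)) (begin
      + x ℤ.* + a    ≡⟨ trans (ℤ.*-comm (+ x) (+ a)) (sym (ℤ.pos-* a x)) ⟩
      + (a * x)    ≈⟨ %≡⇒≡[mod] {a = a * x} {b = a * y} ax%p≡ay%p ⟩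
      + (a * y)    ≡⟨ trans (ℤ.pos-* a y) (ℤ.*-comm (+ a) (+ y)) ⟩
      + y ℤ.* + a    ∎))
    where open ≡[mod]-Reasoning p

  prod-*-mod-nonzeroResidues : ∀ {a} → ¬ (p ∣ a) →
    prod (map (λ x → + (a * x % p)) nonzeroResidues) ≡ prod (map +_ nonzeroResidues)
  prod-*-mod-nonzeroResidues {a} p∤a =
    trans (cong prod (map-∘ R))
          (prod-map-⊆ ℕ._≟_ +_ (map⁺-injectiveOn ax%p inj uR) uR R⊆map (λ y∈ y∉ → ⊥-elim (y∉ (map⊆R y∈))))
    where
    open WithDecEq ℕ._≟_
    R = nonzeroResidues
    uR = nonzeroResidues-unique
    ax%p : ℕ → ℕ
    ax%p x = a * x % p
    into : MapsTo ax%p R R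
    into {x} x∈ = ∈-nonzeroResidues⁺ (ℕ.n≢0⇒n>0 ax%p≢0) (m%n<n _ p)
      where
      ax%p≢0 : ax%p x ≢ 0
      ax%p≢0 ax%p≡0 with euclidsLemma a x prime (m%n≡0⇒n∣m (a * x) p ax%p≡0)
      ... | inj₁ p∣a = p∤a p∣a
      ... | inj₂ p∣x = prime∤nonzeroResidue x∈ p∣x
    inj : InjectiveOn ax%p R
    inj x∈ y∈ = *-%-injective p∤a (proj₂ (∈-nonzeroResidues⁻ x∈)) (proj₂ (∈-nonzeroResidues⁻ y∈))
    map⊆R : map ax%p R ⊆ R
    map⊆R z∈ with x , x∈ , refl ← ∈-map⁻ ax%p z∈ = into x∈
    R⊆map : R ⊆ map ax%p R
    R⊆map y∈ = let x , x∈ , ax%p≡y = injectiveOn⇒covers ax%p uR inj into ℕ.≤-refl y∈ in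
      subst (_∈ map ax%p R) ax%p≡y (∈-map⁺ ax%p x∈)

  fermat : ∀ a → ¬ (p ∣ a) → (+ a) ℤ.^ (p ∸ 1) ≡ + 1 [mod p ]
  fermat a p∤a = *-cancelʳ-mod prime prime∤prod-nonzeroResidues (begin
      (+ a) ℤ.^ (p ∸ 1) ℤ.* ∏R                 ≡⟨ cong (λ k → (+ a) ℤ.^ k ℤ.* ∏R) length-nonzeroResidues ⟨
      (+ a) ℤ.^ length R ℤ.* ∏R                ≡⟨ prod-map-scale (+ a) +_ R ⟨
      prod (map (λ x → + a ℤ.* + x) R)         ≈⟨ prod-cong-mod R (All.tabulate λ {x} _ → ≡[mod]-sym (%-*-≡[mod] x)) ⟩
      prod (map (λ x → + (a * x % p)) R)     ≡⟨ prod-*-mod-nonzeroResidues p∤a ⟩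
      ∏R                                       ≡⟨ ℤ.*-identityˡ ∏R ⟨
      + 1 ℤ.* ∏R                               ∎)
    where
    open ≡[mod]-Reasoning p
    R = nonzeroResidues
    ∏R = prod (map +_ R)
    %-*-≡[mod] : ∀ x → + (a * x % p) ≡ + a ℤ.* + x [mod p ]
    %-*-≡[mod] x = ≡[mod]-trans (%-≡[mod] (a * x)) (≡⇒≡[mod] (ℤ.pos-* a x))

-- Legendre symbols and quadratic residues

-1≢1 : -[1+ 0 ] ≢ + 1
-1≢1 ()

IsSign : ℤ → Set
IsSign j = j ≡ + 1 ⊎ j ≡ -[1+ 0 ]

IsSign-≡[mod] : ∀ {n i j} → 3 ≤ n → IsSign i → IsSign j → i ≡ j [mod n ] → i ≡ j
IsSign-≡[mod] _   (inj₁ refl) (inj₁ refl) _   = refl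
IsSign-≡[mod] 3≤n (inj₁ refl) (inj₂ refl) 1≡-1 = ⊥-elim (1≢-1[mod] 3≤n 1≡-1)
IsSign-≡[mod] 3≤n (inj₂ refl) (inj₁ refl) -1≡1 = ⊥-elim (1≢-1[mod] 3≤n (≡[mod]-sym -1≡1))
IsSign-≡[mod] _   (inj₂ refl) (inj₂ refl) _   = refl

IsSquare : ℕ → ℕ → Set
IsSquare p a = ∃[ x ] (x < p × + (x * x) ≡ + a [mod p ])

-- `QR?` searches x : Fin p; `IsSquare` is the same notion with x : ℕ.
module _ {p a : ℕ} where

  fromQR : ∃[ x ] (Cong (toℕ {p} x * toℕ x) a p) → IsSquare p a
  fromQR (x , x²≡a) = toℕ x , toℕ<n x , CongZ⇒≡[mod] x²≡a

  toQR : IsSquare p a → ∃[ x ] (Cong (toℕ {p} x * toℕ x) a p)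
  toQR (x , x<p , x²≡a) = fromℕ< x<p , subst (λ y → Cong (y * y) a p) (sym (toℕ-fromℕ< x<p)) (≡[mod]⇒CongZ x²≡a)

isSquare? : ∀ p a → Dec (IsSquare p a)
isSquare? p a = map′ fromQR toQR (QR? a p)

module _ {p : ℕ} (prime : Prime p) where

  private
    instance
      p≢0 : NonZero p
      p≢0 = prime⇒nonZero prime

  coprime⇒∤ : ∀ {a} → Coprime a p → ¬ (p ∣ a)
  coprime⇒∤ coprime p∣a = ℕ.nonTrivial⇒≢1 {{prime⇒nonTrivial prime}} (coprime (p∣a , ∣-refl))

  ∤⇒coprime : ∀ {a} → ¬ (p ∣ a) → Coprime a p
  ∤⇒coprime p∤a (d∣a , d∣p) with prime⇒irreducible prime d∣p
  ... | inj₁ d≡1   = d≡1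
  ... | inj₂ refl  = ⊥-elim (p∤a d∣a)

  IsSquare-resp-≡[mod] : ∀ {a b} → + a ≡ + b [mod p ] → IsSquare p a → IsSquare p b
  IsSquare-resp-≡[mod] a≡b (x , x<p , x²≡a) = x , x<p , ≡[mod]-trans x²≡a a≡b

  legendre-∣ : ∀ {a} → p ∣ a → legendre a p ≡ + 0
  legendre-∣ {a} p∣a with p ∣? a
  ... | yes _   = refl
  ... | no  p∤a = ⊥-elim (p∤a p∣a)

  legendre-square : ∀ {a} → ¬ (p ∣ a) → IsSquare p a → legendre a p ≡ + 1
  legendre-square {a} p∤a square with p ∣? a
  ... | yes p∣a = ⊥-elim (p∤a p∣a)
  ... | no  _   with QR? a p
  ...   | yes _      = refl
  ...   | no ¬square = ⊥-elim (¬square (toQR square))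

  legendre-nonsquare : ∀ {a} → ¬ (p ∣ a) → ¬ IsSquare p a → legendre a p ≡ -[1+ 0 ]
  legendre-nonsquare {a} p∤a ¬square with p ∣? a
  ... | yes p∣a = ⊥-elim (p∤a p∣a)
  ... | no  _   with QR? a p
  ...   | yes square = ⊥-elim (¬square (fromQR square))
  ...   | no _       = refl

  legendre-sign : ∀ {a} → ¬ (p ∣ a) → IsSign (legendre a p)
  legendre-sign {a} p∤a with isSquare? p a
  ... | yes square = inj₁ (legendre-square p∤a square)
  ... | no ¬square = inj₂ (legendre-nonsquare p∤a ¬square)

  legendre≡1⇒square : ∀ {a} → legendre a p ≡ + 1 → IsSquare p a
  legendre≡1⇒square {a} leg≡1 = cases (p ∣? a) (isSquare? p a)
    where
    cases : Dec (p ∣ a) → Dec (IsSquare p a) → IsSquare p a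
    cases _         (yes square) = square
    cases (yes p∣a) (no _)       with () ← trans (sym (legendre-∣ {a} p∣a)) leg≡1
    cases (no p∤a)  (no ¬square) with () ← trans (sym (legendre-nonsquare {a} p∤a ¬square)) leg≡1

  legendre-resp-≡[mod] : ∀ {a b} → + a ≡ + b [mod p ] → legendre a p ≡ legendre b p
  legendre-resp-≡[mod] {a} {b} a≡b = cases (p ∣? a) (isSquare? p a)
    where
    b≡a = ≡[mod]-sym a≡b
    cases : Dec (p ∣ a) → Dec (IsSquare p a) → legendre a p ≡ legendre b p
    cases (yes p∣a) _          = trans (legendre-∣ {a} p∣a) (sym (legendre-∣ {b} (∣-resp-≡[mod] ∣-refl a≡b p∣a)))
    cases (no p∤a)  (yes sq)   = trans (legendre-square {a} p∤a sq)
      (sym (legendre-square {b} (p∤a ∘′ ∣-resp-≡[mod] ∣-refl b≡a) (IsSquare-resp-≡[mod] a≡b sq)))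
    cases (no p∤a)  (no ¬sq)   = trans (legendre-nonsquare {a} p∤a ¬sq)
      (sym (legendre-nonsquare {b} (p∤a ∘′ ∣-resp-≡[mod] ∣-refl b≡a) (¬sq ∘′ IsSquare-resp-≡[mod] b≡a)))

private
  difference-of-squares′ : ∀ x y → x ℤ.* x - y ℤ.* y ≡ (x - y) ℤ.* (x ℤ.+ y)
  difference-of-squares′ = ℤ-Solver.solve-∀

  difference-of-squares : ∀ x y → + (x * x) - + (y * y) ≡ (+ x - + y) ℤ.* (+ x ℤ.+ + y)
  difference-of-squares x y = trans (cong₂ _-_ (ℤ.pos-* x x) (ℤ.pos-* y y)) (difference-of-squares′ (+ x) (+ y))

  square-of-negation′ : ∀ p x → (p - x) ℤ.* (p - x) - x ℤ.* x ≡ (p - + 2 ℤ.* x) ℤ.* p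
  square-of-negation′ = ℤ-Solver.solve-∀

square-of-negation : ∀ {p x} → x ≤ p → + ((p ∸ x) * (p ∸ x)) ≡ + (x * x) [mod p ]
square-of-negation {p} {x} x≤p = mod-divides (ℤ∣.divides (+ p - + 2 ℤ.* + x) (begin
  + ((p ∸ x) * (p ∸ x)) - + (x * x)     ≡⟨ cong₂ _-_ (ℤ.pos-* (p ∸ x) (p ∸ x)) (ℤ.pos-* x x) ⟩
  + (p ∸ x) ℤ.* + (p ∸ x) - + x ℤ.* + x ≡⟨ cong (λ z → z ℤ.* z - + x ℤ.* + x) p-x≡ ⟩
  (+ p - + x) ℤ.* (+ p - + x) - + x ℤ.* + x ≡⟨ square-of-negation′ (+ p) (+ x) ⟩
  (+ p - + 2 ℤ.* + x) ℤ.* + p           ∎))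
  where
  open ≡-Reasoning
  p-x≡ : + (p ∸ x) ≡ + p - + x
  p-x≡ = sym (trans (ℤ.[+m]-[+n]≡m⊖n p x) (ℤ.⊖-≥ x≤p))

HasLegendre : ℕ → ℤ → ℕ → Set
HasLegendre p j a = Coprime a p × legendre a p ≡ j

hasLegendre? : ∀ p j → Decidable (HasLegendre p j)
hasLegendre? p j a = coprime? a p ×-dec (legendre a p ℤ.≟ j)

module QuadraticResidues {p h : ℕ} (prime : Prime p) (p≡1+2h : p ≡ suc (2 * h)) where

  open WithDecEq ℕ._≟_ using (bijectiveOn⇒length≡)

  private
    instance
      p≢0 : NonZero p
      p≢0 = prime⇒nonZero prime

  1≤h : 1 ≤ h
  1≤h = ℕ.n≢0⇒n>0 λ h≡0 →
    ℕ.nonTrivial⇒≢1 {{prime⇒nonTrivial prime}} (trans p≡1+2h (cong (λ k → suc (2 * k)) h≡0))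

  private
    h<p : h < p
    h<p = subst (h <_) (sym p≡1+2h) (s≤s (ℕ.m≤m+n h (h + 0)))

    lowerHalf : List ℕ
    lowerHalf = applyUpTo suc h

    ∈-lowerHalf⁻ : ∀ {x} → x ∈ lowerHalf → 0 < x × x ≤ h
    ∈-lowerHalf⁻ x∈ with i , i<h , refl ← ∈-applyUpTo⁻ suc x∈ = s≤s z≤n , i<h

    ∈-lowerHalf⁺ : ∀ {x} → 0 < x → x ≤ h → x ∈ lowerHalf
    ∈-lowerHalf⁺ {suc i} _ x≤h = ∈-applyUpTo⁺ suc x≤h

    lowerHalf-unique : Unique lowerHalf
    lowerHalf-unique = Unique.applyUpTo⁺₁ suc h (λ i<j _ → ℕ.<⇒≢ i<j ∘′ ℕ.suc-injective)

    ∈-lowerHalf⇒<p : ∀ {x} → x ∈ lowerHalf → x < p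
    ∈-lowerHalf⇒<p x∈ = ℕ.≤-<-trans (proj₂ (∈-lowerHalf⁻ x∈)) h<p

    square : ℕ → ℕ
    square x = x * x % p

    p∤square : ∀ {x} → 0 < x → x < p → ¬ (p ∣ square x)
    p∤square {x} 0<x x<p p∣x² = [ p∤x , p∤x ]′ (euclidsLemma x x prime p∣x*x)
      where
      p∤x = prime∤nonzero< prime 0<x x<p
      p∣x*x : p ∣ x * x
      p∣x*x = ∣-resp-≡[mod] {a = x * x % p} {b = x * x} ∣-refl (%-≡[mod] (x * x)) p∣x²

    square-hasLegendre : ∀ {x} → 0 < x → x < p → HasLegendre p (+ 1) (square x)
    square-hasLegendre {x} 0<x x<p =
      ∤⇒coprime prime (p∤square 0<x x<p) ,
      legendre-square prime {square x} (p∤square 0<x x<p) (x , x<p , ≡[mod]-sym (%-≡[mod] (x * x)))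

    squares : List ℕ
    squares = filter (hasLegendre? p (+ 1)) (upTo p)

    square-into : MapsTo square lowerHalf squares
    square-into x∈ = let 0<x , _ = ∈-lowerHalf⁻ x∈ in
      ∈-filter⁺ (hasLegendre? p (+ 1)) (∈-upTo⁺ (m%n<n _ p)) (square-hasLegendre 0<x (∈-lowerHalf⇒<p x∈))

    square-injective : InjectiveOn square lowerHalf
    square-injective {x} {y} x∈ y∈ x²≡y² =
      [ (λ p∣x-y → ≡[mod]-<⇒≡ (∈-lowerHalf⇒<p x∈) (∈-lowerHalf⇒<p y∈) (mod-divides p∣x-y))
      , (λ p∣x+y → ⊥-elim (p∤x+y (subst (p ∣_) (cong ∣_∣ (sym (ℤ.pos-+ x y))) (∣⇒∣ᵤ p∣x+y)))) ]′
      (euclidsLemmaℤ prime (+ x - + y) (+ x ℤ.+ + y) p∣[x-y][x+y])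
      where
      p∣[x-y][x+y] : + p ℤ∣.∣ (+ x - + y) ℤ.* (+ x ℤ.+ + y)
      p∣[x-y][x+y] = subst (_ ℤ∣.∣_) (difference-of-squares x y)
                           (divides-difference (%≡⇒≡[mod] {a = x * x} {b = y * y} x²≡y²))
      p∤x+y : ¬ (p ∣ x + y)
      p∤x+y p∣x+y = ℕ.<⇒≱ (subst (x + y <_) (sym p≡1+2h) (s≤s (ℕ.+-mono-≤ x≤h (subst (y ≤_) (sym (ℕ.+-identityʳ h)) y≤h))))
                          (∣⇒≤ {{ℕ.>-nonZero (ℕ.<-≤-trans 0<x (ℕ.m≤m+n x y))}} p∣x+y)
        where
        0<x = proj₁ (∈-lowerHalf⁻ x∈)
        x≤h = proj₂ (∈-lowerHalf⁻ x∈)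
        y≤h = proj₂ (∈-lowerHalf⁻ y∈)

    square-covers : Covers square lowerHalf squares
    square-covers {a} a∈ = root (legendre≡1⇒square prime {a} leg≡1)
      where
      a∈upTo = proj₁ (∈-filter⁻ (hasLegendre? p (+ 1)) {xs = upTo p} a∈)
      a⊥p = proj₁ (proj₂ (∈-filter⁻ (hasLegendre? p (+ 1)) {xs = upTo p} a∈))
      leg≡1 = proj₂ (proj₂ (∈-filter⁻ (hasLegendre? p (+ 1)) {xs = upTo p} a∈))
      square≡a : ∀ {z} → + (z * z) ≡ + a [mod p ] → square z ≡ a
      square≡a {z} z²≡a = trans (≡[mod]⇒%≡ {a = z * z} {b = a} z²≡a) (m<n⇒m%n≡m (∈-upTo⁻ a∈upTo))
      root : IsSquare p a → ∃[ x ] (x ∈ lowerHalf × square x ≡ a)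
      root (zero , _ , 0≡a) = ⊥-elim (coprime⇒∤ prime a⊥p (∣-resp-≡[mod] {a = 0} {b = a} ∣-refl 0≡a (p ∣0)))
      root (suc x , x<p , x²≡a) with suc x ℕ.≤? h
      ... | yes x≤h = suc x , ∈-lowerHalf⁺ (s≤s z≤n) x≤h , square≡a {suc x} x²≡a
      ... | no  x≰h = p ∸ suc x , ∈-lowerHalf⁺ (ℕ.m<n⇒0<n∸m x<p) p-x≤h ,
                      square≡a {p ∸ suc x} (≡[mod]-trans (square-of-negation (ℕ.<⇒≤ x<p)) x²≡a)
        where
        p∸[1+h]≡h : p ∸ suc h ≡ h
        p∸[1+h]≡h = trans (cong (_∸ suc h) p≡1+2h) (trans (ℕ.m+n∸m≡n h (h + 0)) (ℕ.+-identityʳ h))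
        p-x≤h : p ∸ suc x ≤ h
        p-x≤h = ℕ.≤-trans (ℕ.∸-monoʳ-≤ p (ℕ.≰⇒> x≰h)) (ℕ.≤-reflexive p∸[1+h]≡h)

  count-squares : count (hasLegendre? p (+ 1)) (upTo p) ≡ h
  count-squares = trans (sym (bijectiveOn⇒length≡ square lowerHalf-unique square-injective square-into
                                (Unique.filter⁺ (hasLegendre? p (+ 1)) (Unique.upTo⁺ p)) square-covers))
                        (length-applyUpTo suc h)

  count-units : count (λ a → coprime? a p) (upTo p) ≡ 2 * h
  count-units = begin
    count (λ a → coprime? a p) (upTo p)  ≡⟨ bijectiveOn⇒length≡ id unitsUnique (λ _ _ → id) into (nonzeroResidues-unique prime) covers ⟩
    length (nonzeroResidues prime)       ≡⟨ length-nonzeroResidues prime ⟩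
    p ∸ 1                                ≡⟨ cong (_∸ 1) p≡1+2h ⟩
    2 * h                                ∎
    where
    open ≡-Reasoning
    units = filter (λ a → coprime? a p) (upTo p)
    unitsUnique = Unique.filter⁺ (λ a → coprime? a p) (Unique.upTo⁺ p)
    into : MapsTo id units (nonzeroResidues prime)
    into {x} x∈ = let x∈upTo , x⊥p = ∈-filter⁻ (λ a → coprime? a p) {xs = upTo p} x∈ in
      ∈-nonzeroResidues⁺ prime (ℕ.n≢0⇒n>0 λ x≡0 → coprime⇒∤ prime x⊥p (subst (p ∣_) (sym x≡0) (p ∣0)))
                               (∈-upTo⁻ x∈upTo)
    covers : Covers id units (nonzeroResidues prime)
    covers {y} y∈ = let 0<y , y<p = ∈-nonzeroResidues⁻ prime y∈ in
      y , ∈-filter⁺ (λ a → coprime? a p) (∈-upTo⁺ y<p) (∤⇒coprime prime (prime∤nonzero< prime 0<y y<p)) , refl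

  count-nonsquares : count (hasLegendre? p -[1+ 0 ]) (upTo p) ≡ h
  count-nonsquares = ℕ.+-cancelˡ-≡ h _ _ (begin
    h + count (hasLegendre? p -[1+ 0 ]) (upTo p)
      ≡⟨ cong₂ _+_ count-squares nonsquares≡ ⟨
    count (unit? ∩? legendre≡1?) (upTo p) + count (unit? ∩? ∁? legendre≡1?) (upTo p)
      ≡⟨ count-split unit? legendre≡1? (upTo p) ⟨
    count unit? (upTo p)
      ≡⟨ count-units ⟩
    2 * h
      ≡⟨ cong (λ k → h + k) (ℕ.+-identityʳ h) ⟩
    h + h ∎)
    where
    open ≡-Reasoning
    unit? : Decidable (λ a → Coprime a p)
    unit? a = coprime? a p
    legendre≡1? : Decidable (λ a → legendre a p ≡ + 1)
    legendre≡1? a = legendre a p ℤ.≟ + 1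
    nonsquares≡ : count (unit? ∩? ∁? legendre≡1?) (upTo p) ≡ count (hasLegendre? p -[1+ 0 ]) (upTo p)
    nonsquares≡ = count-cong (unit? ∩? ∁? legendre≡1?) (hasLegendre? p -[1+ 0 ]) (upTo p)
      (λ {a} _ (a⊥p , leg≢1) → a⊥p , [ ⊥-elim ∘′ leg≢1 , id ]′ (legendre-sign prime {a} (coprime⇒∤ prime a⊥p)))
      (λ _ (a⊥p , leg≡-1) → a⊥p , λ leg≡1 → -1≢1 (trans (sym leg≡-1) leg≡1))

  -- The residues b and x² (1 ≤ x ≤ h) would be h + 1 distinct roots of X^h - 1.
  nonsquare^h≢1 : ∀ {b} → legendre b p ≡ -[1+ 0 ] → ¬ ((+ b) ℤ.^ h ≡ + 1 [mod p ])
  nonsquare^h≢1 {b} leg≡-1 b^h≡1 = ℕ.<-irrefl refl (ℕ.<-≤-trans (s≤s ℕ.≤-refl) h+1≤h)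
    where
    rs : List ℕ
    rs = b % p ∷ map square lowerHalf
    b%p∉squares : All (b % p ≢_) (map square lowerHalf)
    b%p∉squares = All.map⁺ (All.tabulate λ {x} x∈ b%p≡x² → -1≢1 (begin
      -[1+ 0 ]          ≡⟨ trans (sym leg≡-1) (legendre-resp-≡[mod] prime {b} {b % p} (≡[mod]-sym (%-≡[mod] b))) ⟩
      legendre (b % p) p ≡⟨ cong (λ z → legendre z p) b%p≡x² ⟩
      legendre (square x) p ≡⟨ proj₂ (square-hasLegendre (proj₁ (∈-lowerHalf⁻ x∈)) (∈-lowerHalf⇒<p x∈)) ⟩
      + 1               ∎))
      where
      open ≡-Reasoning
    rs-unique : Unique rs
    rs-unique = b%p∉squares ∷ map⁺-injectiveOn square square-injective lowerHalf-unique
    rs<p : All (_< p) rs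
    rs<p = m%n<n b p ∷ All.map⁺ (All.tabulate λ _ → m%n<n _ p)
    square^h≡1 : ∀ {x} → x ∈ lowerHalf → (+ square x) ℤ.^ h ≡ + 1 [mod p ]
    square^h≡1 {x} x∈ = begin
      (+ square x) ℤ.^ h        ≈⟨ ^-cong-mod h (%-≡[mod] (x * x)) ⟩
      (+ (x * x)) ℤ.^ h         ≡⟨ cong (ℤ._^ h) (trans (ℤ.pos-* x x) (cong (+ x ℤ.*_) (sym (ℤ.*-identityʳ (+ x))))) ⟩
      ((+ x) ℤ.^ 2) ℤ.^ h       ≡⟨ ℤ.^-*-assoc (+ x) 2 h ⟩
      (+ x) ℤ.^ (2 * h)         ≡⟨ cong ((+ x) ℤ.^_) (cong (_∸ 1) p≡1+2h) ⟨
      (+ x) ℤ.^ (p ∸ 1)         ≈⟨ fermat prime x (prime∤nonzero< prime (proj₁ (∈-lowerHalf⁻ x∈)) (∈-lowerHalf⇒<p x∈)) ⟩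
      + 1                       ∎
      where open ≡[mod]-Reasoning p
    roots : All (λ r → (+ r) ℤ.^ h ≡ + 1 [mod p ]) rs
    roots = ≡[mod]-trans (^-cong-mod h (%-≡[mod] b)) b^h≡1 ∷ All.map⁺ (All.tabulate square^h≡1)
    h+1≤h : suc h ≤ h
    h+1≤h = subst₂ _≤_ length-rs suc[pred[h]]≡h
      (powRootsBound prime (ℕ.pred h) rs rs-unique rs<p
        (subst (λ k → All (λ r → (+ r) ℤ.^ k ≡ + 1 [mod p ]) rs) (sym suc[pred[h]]≡h) roots))
      where
      suc[pred[h]]≡h : suc (ℕ.pred h) ≡ h
      suc[pred[h]]≡h = ℕ.suc-pred h {{ℕ.>-nonZero 1≤h}}
      length-rs : length rs ≡ suc h
      length-rs = cong suc (trans (length-map square lowerHalf) (length-applyUpTo suc h))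

-- Chinese remainder theorem, squarefree products and the Jacobi symbol

coprime-*⁻ˡ : ∀ {a m n} → Coprime a (m * n) → Coprime a m
coprime-*⁻ˡ {n = n} a⊥mn (d∣a , d∣m) = a⊥mn (d∣a , ∣-trans d∣m (m∣m*n n))

coprime-*⁻ʳ : ∀ {a m n} → Coprime a (m * n) → Coprime a n
coprime-*⁻ʳ {m = m} a⊥mn (d∣a , d∣n) = a⊥mn (d∣a , ∣-trans d∣n (n∣m*n m))

coprime-*⁺ : ∀ {a m n} → Coprime a m → Coprime a n → Coprime a (m * n)
coprime-*⁺ a⊥m a⊥n (d∣a , d∣mn) = a⊥n (d∣a , coprime-divisor (λ (e∣d , e∣m) → a⊥m (∣-trans e∣d d∣a , e∣m)) d∣mn)

coprime-∣⇒*∣ : ∀ {m n k} → Coprime m n → m ∣ k → n ∣ k → m * n ∣ k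
coprime-∣⇒*∣ {m} {n} m⊥n m∣k (divides j refl) with coprime-divisor m⊥n (subst (m ∣_) (ℕ.*-comm j n) m∣k)
... | divides i refl = divides i (ℕ.*-assoc i m n)

length-cartesianProduct : ∀ (xs : List A) (ys : List B) →
                          length (cartesianProduct xs ys) ≡ length xs * length ys
length-cartesianProduct []       ys = refl
length-cartesianProduct (x ∷ xs) ys =
  trans (length-++ (map (x ,_) ys)) (cong₂ _+_ (length-map (x ,_) ys) (length-cartesianProduct xs ys))

module ChineseRemainder {p m : ℕ} .{{_ : NonZero p}} .{{_ : NonZero m}} (p⊥m : Coprime p m) where

  open WithDecEq (≡-dec ℕ._≟_ ℕ._≟_) using (injectiveOn⇒covers; bijectiveOn⇒length≡)

  private
    instance
      pm≢0 : NonZero (p * m)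
      pm≢0 = ℕ.m*n≢0 p m

    residues : ℕ → ℕ × ℕ
    residues a = a % p , a % m

    residues-injective : ∀ {a b} → a < p * m → b < p * m → residues a ≡ residues b → a ≡ b
    residues-injective {a} {b} a<pm b<pm a≡b = ≡[mod]-<⇒≡ a<pm b<pm (mod-divides (∣ᵤ⇒∣ pm∣a-b))
      where
      pm∣a-b = coprime-∣⇒*∣ p⊥m (∣⇒∣ᵤ (divides-difference (%≡⇒≡[mod] {a = a} {b = b} (cong proj₁ a≡b))))
                                (∣⇒∣ᵤ (divides-difference (%≡⇒≡[mod] {a = a} {b = b} (cong proj₂ a≡b))))

    residues-injectiveOn : ∀ {xs} → xs ⊆ upTo (p * m) → InjectiveOn residues xs
    residues-injectiveOn xs⊆ a∈ b∈ = residues-injective (∈-upTo⁻ (xs⊆ a∈)) (∈-upTo⁻ (xs⊆ b∈))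

  crt : ∀ {b c} → b < p → c < m → ∃[ a ] (a < p * m × a % p ≡ b × a % m ≡ c)
  crt b<p c<m =
    let a , a∈ , a↦bc = injectiveOn⇒covers residues (Unique.upTo⁺ (p * m)) (residues-injectiveOn id) into
                          (ℕ.≤-reflexive size≡) (∈-cartesianProduct⁺ (∈-upTo⁺ b<p) (∈-upTo⁺ c<m))
    in a , ∈-upTo⁻ a∈ , cong proj₁ a↦bc , cong proj₂ a↦bc
    where
    into : MapsTo residues (upTo (p * m)) (cartesianProduct (upTo p) (upTo m))
    into {a} _ = ∈-cartesianProduct⁺ (∈-upTo⁺ (m%n<n a p)) (∈-upTo⁺ (m%n<n a m))
    size≡ : length (cartesianProduct (upTo p) (upTo m)) ≡ length (upTo (p * m))
    size≡ = trans (length-cartesianProduct (upTo p) (upTo m))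
                  (trans (cong₂ _*_ (length-upTo p) (length-upTo m)) (sym (length-upTo (p * m))))

  count-crt : ∀ {P Q : ℕ → Set} (P? : Decidable P) (Q? : Decidable Q) →
              count (λ a → P? (a % p) ×-dec Q? (a % m)) (upTo (p * m)) ≡ count P? (upTo p) * count Q? (upTo m)
  count-crt {P} {Q} P? Q? =
    trans (bijectiveOn⇒length≡ residues (Unique.filter⁺ R? (Unique.upTo⁺ (p * m)))
             (residues-injectiveOn (proj₁ ∘′ ∈-filter⁻ R?)) into
             (Unique.cartesianProduct⁺ (Unique.filter⁺ P? (Unique.upTo⁺ p)) (Unique.filter⁺ Q? (Unique.upTo⁺ m)))
             covers)
          (length-cartesianProduct (filter P? (upTo p)) (filter Q? (upTo m)))
    where
    R? : Decidable (λ a → P (a % p) × Q (a % m))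
    R? a = P? (a % p) ×-dec Q? (a % m)
    into : MapsTo residues (filter R? (upTo (p * m))) (cartesianProduct (filter P? (upTo p)) (filter Q? (upTo m)))
    into {a} a∈ = let _ , Pa , Qa = ∈-filter⁻ R? {xs = upTo (p * m)} a∈ in
      ∈-cartesianProduct⁺ (∈-filter⁺ P? (∈-upTo⁺ (m%n<n a p)) Pa) (∈-filter⁺ Q? (∈-upTo⁺ (m%n<n a m)) Qa)
    covers : Covers residues (filter R? (upTo (p * m))) (cartesianProduct (filter P? (upTo p)) (filter Q? (upTo m)))
    covers {b , c} bc∈ =
      let b∈ , c∈ = ∈-cartesianProduct⁻ (filter P? (upTo p)) (filter Q? (upTo m)) bc∈
          b∈upTo , Pb = ∈-filter⁻ P? {xs = upTo p} b∈
          c∈upTo , Qc = ∈-filter⁻ Q? {xs = upTo m} c∈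
          a , a<pm , a%p≡b , a%m≡c = crt (∈-upTo⁻ b∈upTo) (∈-upTo⁻ c∈upTo)
      in a , ∈-filter⁺ R? (∈-upTo⁺ a<pm) (subst P (sym a%p≡b) Pb , subst Q (sym a%m≡c) Qc) , cong₂ _,_ a%p≡b a%m≡c

  unit-lift : ∀ {b} → Coprime b p → ∃[ a ] (Coprime a (p * m) × + a ≡ + b [mod p ])
  unit-lift {b} b⊥p =
    let a , _ , a%p≡b%p , a%m≡1%m = crt (m%n<n b p) (m%n<n 1 m)
        a≡b = %≡⇒≡[mod] {a = a} {b = b} a%p≡b%p
        a≡1 = %≡⇒≡[mod] {a = a} {b = 1} a%m≡1%m
    in a , coprime-*⁺ (coprime-resp-≡[mod] (≡[mod]-sym a≡b) b⊥p)
                      (coprime-resp-≡[mod] (≡[mod]-sym a≡1) (Coprime.1-coprimeTo m)) , a≡b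

prime∉⇒∤product : ∀ {ps q} → All Prime ps → Prime q → q ∉ ps → ¬ (q ∣ product ps)
prime∉⇒∤product primes q-prime q∉ps q∣Πps = q∉ps (factorisationHasAllPrimeFactors q-prime q∣Πps primes)

product-∣ : ∀ {ps x} → All Prime ps → Unique ps → (∀ {q} → q ∈ ps → q ∣ x) → product ps ∣ x
product-∣ {[]}     {x} _                  _          _    = 1∣ x
product-∣ {q ∷ qs} (q-prime ∷ primes) (q∉ ∷ uqs) qs∣x =
  coprime-∣⇒*∣ (Coprime.sym (∤⇒coprime q-prime (prime∉⇒∤product primes q-prime (λ q∈ → All.lookup q∉ q∈ refl))))
               (qs∣x (here refl)) (product-∣ primes uqs (qs∣x ∘′ there))

product-split : ∀ {ps p} → All Prime ps → Unique ps → p ∈ ps → ∃[ m ] (product ps ≡ p * m × ¬ (p ∣ m))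
product-split {q ∷ qs} (q-prime ∷ primes) (q∉ ∷ _) (here refl) =
  product qs , refl , prime∉⇒∤product primes q-prime (λ q∈ → All.lookup q∉ q∈ refl)
product-split {q ∷ qs} {p} (q-prime ∷ primes) (q∉ ∷ uqs) (there p∈) =
  let m , Πqs≡pm , p∤m = product-split primes uqs p∈ in
  q * m , trans (cong (q *_) Πqs≡pm) (x∙yz≈y∙xz q p m) , [ q≢p ∘′ prime∣prime , p∤m ]′ ∘′ euclidsLemma q m p-prime
  where
  p-prime = All.lookup primes p∈
  q≢p : p ≢ q
  q≢p p≡q = All.lookup q∉ p∈ (sym p≡q)
  prime∣prime : p ∣ q → p ≡ q
  prime∣prime p∣q = [ (λ p≡1 → ⊥-elim (ℕ.nonTrivial⇒≢1 {{prime⇒nonTrivial p-prime}} p≡1)) , id ]′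
                      (prime⇒irreducible q-prime p∣q)

mult-∤ : ∀ {p n} → ¬ (p ∣ n) → mult p n ≡ 0
mult-∤ {p} {n} p∤n = count-none (λ e → (p ^ e) ∣? n) (All.tabulate λ e∈ pᵉ∣n → p∤n (∣-trans (p∣pᵉ e∈) pᵉ∣n))
  where
  p∣pᵉ : ∀ {e} → e ∈ applyUpTo suc n → p ∣ p ^ e
  p∣pᵉ e∈ = let i , _ , e≡1+i = ∈-applyUpTo⁻ suc e∈ in subst (λ e → p ∣ p ^ e) (sym e≡1+i) (m∣m*n (p ^ i))

mult-squarefree : ∀ {p n} → 0 < n → p ∣ n → ¬ (p * p ∣ n) → mult p n ≡ 1
mult-squarefree {p} {suc n} _ p∣n p²∤n =
  trans (cong length (filter-accept (λ e → (p ^ e) ∣? suc n) (subst (_∣ suc n) (sym (ℕ.*-identityʳ p)) p∣n)))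
        (cong suc (count-none (λ e → (p ^ e) ∣? suc n) (All.tabulate λ e∈ pᵉ∣n → p²∤n (∣-trans (p²∣pᵉ e∈) pᵉ∣n))))
  where
  p²∣pᵉ : ∀ {e} → e ∈ applyUpTo (suc ∘′ suc) n → p * p ∣ p ^ e
  p²∣pᵉ e∈ = let i , _ , e≡2+i = ∈-applyUpTo⁻ (suc ∘′ suc) e∈ in
    subst (λ e → p * p ∣ p ^ e) (sym e≡2+i) (*-monoʳ-∣ p (subst (_∣ p * p ^ i) (ℕ.*-identityʳ p) (*-monoʳ-∣ p (1∣ (p ^ i)))))

jacobiFactor : ℕ → ℕ → ℕ → ℤ
jacobiFactor a n q with prime? q
... | yes _ = legendre a q ℤ.^ mult q n
... | no  _ = + 1

private
  ≡-*-prod-map-≗ : ∀ {z c} {F G : ℕ → ℤ} xs → z ≡ c ℤ.* prod (map F xs) → (∀ q → F q ≡ G q) →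
                   z ≡ c ℤ.* prod (map G xs)
  ≡-*-prod-map-≗ {c = c} xs z≡ F≗G = trans z≡ (cong (λ ys → c ℤ.* prod ys) (map-cong F≗G xs))

-- `jacobi` multiplies a factor function local to its `where` block; the `refl` in `unfold`
-- names it, and `factor≗`, checked after `unfold` in the mutual block, compares it with
-- `jacobiFactor` case by case.
jacobi≡prod-jacobiFactor : ∀ a n → jacobi a n ≡ prod (map (jacobiFactor a n) (upTo (suc n)))
jacobi≡prod-jacobiFactor a n = unfold
  where
  mutual
    unfold : jacobi a n ≡ prod (map (jacobiFactor a n) (upTo (suc n)))
    unfold = ≡-*-prod-map-≗ {c = + 1} (applyUpTo suc n) refl factor≗

    factor≗ : ∀ q → _ ≡ jacobiFactor a n q
    factor≗ q with prime? q
    ... | yes _ = refl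
    ... | no  _ = refl

jacobi-squarefree : ∀ {ps} a → All Prime ps → Unique ps → jacobi a (product ps) ≡ prod (map (λ p → legendre a p) ps)
jacobi-squarefree {ps} a primes unique = begin
  jacobi a n                                     ≡⟨ jacobi≡prod-jacobiFactor a n ⟩
  prod (map (jacobiFactor a n) (upTo (suc n)))    ≡⟨ prod-map-⊆ ℕ._≟_ (jacobiFactor a n) (Unique.upTo⁺ (suc n)) unique ps⊆ outside≡1 ⟩
  prod (map (jacobiFactor a n) ps)               ≡⟨ cong prod (map-cong-local (All.tabulate factor≡legendre)) ⟩
  prod (map (λ p → legendre a p) ps)             ∎
  where
  open ≡-Reasoning
  n = product ps
  0<n : 0 < n
  0<n = productOfPrimes≥1 primes
  ps⊆ : ps ⊆ upTo (suc n)
  ps⊆ p∈ = ∈-upTo⁺ (s≤s (∣⇒≤ {{ℕ.>-nonZero 0<n}} (∈⇒∣product p∈)))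
  outside≡1 : ∀ {q} → q ∈ upTo (suc n) → q ∉ ps → jacobiFactor a n q ≡ + 1
  outside≡1 {q} _ q∉ps with prime? q
  ... | yes q-prime = cong (legendre a q ℤ.^_) (mult-∤ (prime∉⇒∤product primes q-prime q∉ps))
  ... | no  _       = refl
  factor≡legendre : ∀ {p} → p ∈ ps → jacobiFactor a n p ≡ legendre a p
  factor≡legendre {p} p∈ with prime? p
  ... | no ¬prime = ⊥-elim (¬prime (All.lookup primes p∈))
  ... | yes p-prime = trans (cong (legendre a p ℤ.^_) mult≡1) (ℤ.*-identityʳ (legendre a p))
    where
    mult≡1 : mult p n ≡ 1
    mult≡1 = let m , n≡pm , p∤m = product-split primes unique p∈ in
      mult-squarefree 0<n (∈⇒∣product p∈)
        (λ p²∣n → p∤m (*-cancelˡ-∣ p {{prime⇒nonZero p-prime}} (subst (p * p ∣_) n≡pm p²∣n)))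

-- Parity, and units counted by their Legendre symbols

2∤1 : ¬ (2 ∣ 1)
2∤1 2∣1 = ℕ.<⇒≱ (ℕ.n<1+n 1) (∣⇒≤ 2∣1)

≡1[mod2]⇒2∤ : ∀ {n} → Cong n 1 2 → ¬ (2 ∣ n)
≡1[mod2]⇒2∤ {zero}  2∣1 _      = 2∤1 2∣1
≡1[mod2]⇒2∤ {suc m} 2∣m 2∣1+m = 2∤1 (∣m+n∣m⇒∣n (subst (2 ∣_) (ℕ.+-comm 1 m) 2∣1+m) 2∣m)

2∤⇒≡1+2*[/2] : ∀ {n} → ¬ (2 ∣ n) → n ≡ suc (2 * (n / 2))
2∤⇒≡1+2*[/2] {n} 2∤n = begin
  n                   ≡⟨ m≡m%n+[m/n]*n n 2 ⟩
  n % 2 + n / 2 * 2   ≡⟨ cong₂ _+_ n%2≡1 (ℕ.*-comm (n / 2) 2) ⟩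
  suc (2 * (n / 2))   ∎
  where
  open ≡-Reasoning
  n%2≡1 : n % 2 ≡ 1
  n%2≡1 with n % 2 | m%n<n n 2 | m%n≡0⇒n∣m n 2
  ... | zero    | _                 | 2∣n = ⊥-elim (2∤n (2∣n refl))
  ... | suc zero | _                | _   = refl
  ... | suc (suc _) | s≤s (s≤s ()) | _

2∤-* : ∀ {a b} → ¬ (2 ∣ a) → ¬ (2 ∣ b) → ¬ (2 ∣ a * b)
2∤-* {a} {b} 2∤a 2∤b = [ 2∤a , 2∤b ]′ ∘′ euclidsLemma a b prime[2]

2∤-+2* : ∀ {k t} → ¬ (2 ∣ k + 2 * t) → ¬ (2 ∣ k)
2∤-+2* {k} {t} 2∤k+2t 2∣k = 2∤k+2t (∣m∣n⇒∣m+n 2∣k (m∣m*n t))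

2^j∣*2∤⇒2^j∣ : ∀ j {d t} → 2 ^ j ∣ d * t → ¬ (2 ∣ t) → 2 ^ j ∣ d
2^j∣*2∤⇒2^j∣ zero    {d}     _        _   = divides d (sym (ℕ.*-identityʳ d))
2^j∣*2∤⇒2^j∣ (suc j) {d} {t} 2^j+1∣dt 2∤t with euclidsLemma d t prime[2] (∣-trans (m∣m*n (2 ^ j)) 2^j+1∣dt)
... | inj₂ 2∣t = ⊥-elim (2∤t 2∣t)
... | inj₁ (divides d′ d≡d′*2) = subst (2 ^ suc j ∣_) (sym d≡2d′) (*-monoʳ-∣ {2 ^ j} {d′} 2 (2^j∣*2∤⇒2^j∣ j 2^j∣d′t 2∤t))
  where
  d≡2d′ : d ≡ 2 * d′
  d≡2d′ = trans d≡d′*2 (ℕ.*-comm d′ 2)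
  2^j∣d′t : 2 ^ j ∣ d′ * t
  2^j∣d′t = *-cancelˡ-∣ {2 ^ j} {d′ * t} 2 (subst (2 ^ suc j ∣_) (trans (cong (_* t) d≡2d′) (ℕ.*-assoc 2 d′ t)) 2^j+1∣dt)

IsV2⇒oddPart : ∀ {x N} → IsV2 x N → ∃[ u ] (¬ (2 ∣ u) × x ≡ u * 2 ^ N)
IsV2⇒oddPart {x} {N} (divides u x≡u*2^N , 2^N+1∤x) = u , 2∤u , x≡u*2^N
  where
  2∤u : ¬ (2 ∣ u)
  2∤u (divides r u≡r*2) = 2^N+1∤x (divides r (trans x≡u*2^N (trans (cong (_* 2 ^ N) u≡r*2) (ℕ.*-assoc r 2 (2 ^ N)))))

∣-2^j∣-2^j∤⇒2*∣ : ∀ {d m j} → d ∣ m → 2 ^ j ∣ m → ¬ (2 ^ j ∣ d) → 2 * d ∣ m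
∣-2^j∣-2^j∤⇒2*∣ {d} {m} {j} (divides t m≡t*d) 2^j∣m 2^j∤d with 2 ∣? t
... | no  2∤t = ⊥-elim (2^j∤d (2^j∣*2∤⇒2^j∣ j (subst (2 ^ j ∣_) (trans m≡t*d (ℕ.*-comm t d)) 2^j∣m) 2∤t))
... | yes (divides s t≡s*2) = divides s (trans m≡t*d (trans (cong (_* d) t≡s*2) (ℕ.*-assoc s 2 d)))

signVectors : ℕ → List (List ℤ)
signVectors zero    = [] ∷ []
signVectors (suc k) = map (+ 1 ∷_) (signVectors k) ++ map (-[1+ 0 ] ∷_) (signVectors k)

length-signVectors : ∀ k → length (signVectors k) ≡ 2 ^ k
length-signVectors zero    = refl
length-signVectors (suc k) = begin
  length (map (+ 1 ∷_) (signVectors k) ++ map (-[1+ 0 ] ∷_) (signVectors k))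
    ≡⟨ length-++ (map (+ 1 ∷_) (signVectors k)) ⟩
  length (map (+ 1 ∷_) (signVectors k)) + length (map (-[1+ 0 ] ∷_) (signVectors k))
    ≡⟨ cong₂ _+_ (length-map _ (signVectors k)) (trans (length-map _ (signVectors k)) (sym (ℕ.+-identityʳ _))) ⟩
  length (signVectors k) + (length (signVectors k) + 0)
    ≡⟨ cong (λ l → l + (l + 0)) (length-signVectors k) ⟩
  2 ^ suc k ∎
  where open ≡-Reasoning

count-signVectors : ∀ {S : List ℤ → Set} (S? : Decidable S) k → count S? (signVectors (suc k)) ≡
  count (λ σ → S? (+ 1 ∷ σ)) (signVectors k) + count (λ σ → S? (-[1+ 0 ] ∷ σ)) (signVectors k)
count-signVectors S? k = trans (count-++ S? (map (+ 1 ∷_) (signVectors k)) _)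
  (cong₂ _+_ (count-map S? (+ 1 ∷_) (signVectors k)) (count-map S? (-[1+ 0 ] ∷_) (signVectors k)))

legendreVector : List ℕ → ℕ → List ℤ
legendreVector ps a = map (λ p → legendre a p) ps

legendreVector-resp-≡[mod] : ∀ {ps m a b} → All Prime ps → (∀ {q} → q ∈ ps → q ∣ m) →
                             + a ≡ + b [mod m ] → legendreVector ps a ≡ legendreVector ps b
legendreVector-resp-≡[mod] {ps} primes ps∣m a≡b = map-cong-local (All.tabulate λ {q} q∈ →
  legendre-resp-≡[mod] (All.lookup primes q∈) (≡[mod]-divisor (ps∣m q∈) a≡b))

module _ {p : ℕ} {ps : List ℕ} (p-prime : Prime p) (primes : All Prime ps) (p∉ps : p ∉ ps) where

  private
    m = product ps
    instance
      p≢0 : NonZero p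
      p≢0 = prime⇒nonZero p-prime
      m≢0 : NonZero m
      m≢0 = ℕ.>-nonZero (productOfPrimes≥1 primes)

    p⊥m : Coprime p m
    p⊥m = Coprime.sym (∤⇒coprime p-prime (prime∉⇒∤product primes p-prime p∉ps))

    legendre-%p : ∀ a → legendre (a % p) p ≡ legendre a p
    legendre-%p a = legendre-resp-≡[mod] p-prime (%-≡[mod] a)

    legendreVector-%m : ∀ a → legendreVector ps (a % m) ≡ legendreVector ps a
    legendreVector-%m a = legendreVector-resp-≡[mod] primes ∈⇒∣product (%-≡[mod] a)

    coprime-%⇒ : ∀ {a} → Coprime (a % p) p → Coprime (a % m) m → Coprime a (p * m)
    coprime-%⇒ {a} a%p⊥p a%m⊥m = coprime-*⁺ (coprime-resp-≡[mod] (%-≡[mod] a) a%p⊥p) (coprime-resp-≡[mod] (%-≡[mod] a) a%m⊥m)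

    coprime⇒% : ∀ {a} → Coprime a (p * m) → Coprime (a % p) p × Coprime (a % m) m
    coprime⇒% {a} a⊥pm = coprime-resp-≡[mod] (≡[mod]-sym (%-≡[mod] a)) (coprime-*⁻ˡ a⊥pm)
                       , coprime-resp-≡[mod] (≡[mod]-sym (%-≡[mod] a)) (coprime-*⁻ʳ {m = p} a⊥pm)

  count-by-first-sign : ∀ {S : List ℤ → Set} (S? : Decidable S) j →
    count (λ a → (coprime? a (p * m) ×-dec S? (legendreVector (p ∷ ps) a)) ×-dec (legendre a p ℤ.≟ j)) (upTo (p * m))
    ≡ count (hasLegendre? p j) (upTo p) * count (λ c → coprime? c m ×-dec S? (j ∷ legendreVector ps c)) (upTo m)
  count-by-first-sign {S} S? j = trans (count-cong _ _ (upTo (p * m)) split join)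
    (ChineseRemainder.count-crt p⊥m (hasLegendre? p j) (λ c → coprime? c m ×-dec S? (j ∷ legendreVector ps c)))
    where
    split : ∀ {a} → a ∈ upTo (p * m) → (Coprime a (p * m) × S (legendreVector (p ∷ ps) a)) × legendre a p ≡ j →
            HasLegendre p j (a % p) × (Coprime (a % m) m × S (j ∷ legendreVector ps (a % m)))
    split {a} _ ((a⊥pm , Sa) , leg≡j) = let a%p⊥p , a%m⊥m = coprime⇒% a⊥pm in
      (a%p⊥p , trans (legendre-%p a) leg≡j) , a%m⊥m , subst S (cong₂ _∷_ leg≡j (sym (legendreVector-%m a))) Sa
    join : ∀ {a} → a ∈ upTo (p * m) → HasLegendre p j (a % p) × (Coprime (a % m) m × S (j ∷ legendreVector ps (a % m))) →
           (Coprime a (p * m) × S (legendreVector (p ∷ ps) a)) × legendre a p ≡ j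
    join {a} _ ((a%p⊥p , leg≡j) , a%m⊥m , Sa%m) = let leg≡j′ = trans (sym (legendre-%p a)) leg≡j in
      (coprime-%⇒ a%p⊥p a%m⊥m , subst S (cong₂ _∷_ (sym leg≡j′) (legendreVector-%m a)) Sa%m) , leg≡j′

halfProduct : List ℕ → ℕ
halfProduct ps = product (map (_/ 2) ps)

private
  collect : ∀ h a b H → h * (a * H) + h * (b * H) ≡ (a + b) * (h * H)
  collect = ℕ-Solver.solve-∀

count-legendreVector : ∀ {ps} → All Prime ps → All (λ p → Cong p 1 2) ps → Unique ps →
  ∀ {S : List ℤ → Set} (S? : Decidable S) →
  count (λ a → coprime? a (product ps) ×-dec S? (legendreVector ps a)) (upTo (product ps))
  ≡ count S? (signVectors (length ps)) * halfProduct ps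
count-legendreVector {[]} _ _ _ S? with S? []
... | yes _ = refl
... | no  _ = refl
count-legendreVector {p ∷ ps} (p-prime ∷ primes) (p-odd ∷ odds) (p≢ps ∷ unique) {S} S? = begin
  count P? (upTo (p * m))
    ≡⟨ count-split P? sign≡1? (upTo (p * m)) ⟩
  count (P? ∩? sign≡1?) (upTo (p * m)) + count (P? ∩? ∁? sign≡1?) (upTo (p * m))
    ≡⟨ cong₂ _+_ refl sign≢1⇔sign≡-1 ⟩
  count (P? ∩? sign≡1?) (upTo (p * m)) + count (P? ∩? sign≡-1?) (upTo (p * m))
    ≡⟨ cong₂ _+_ (count-by-first-sign p-prime primes p∉ps S? (+ 1)) (count-by-first-sign p-prime primes p∉ps S? -[1+ 0 ]) ⟩
  count (hasLegendre? p (+ 1)) (upTo p) * count B₊? (upTo m) + count (hasLegendre? p -[1+ 0 ]) (upTo p) * count B₋? (upTo m)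
    ≡⟨ cong₂ _+_ (cong₂ _*_ count-squares (count-legendreVector primes odds unique (λ σ → S? (+ 1 ∷ σ))))
                 (cong₂ _*_ count-nonsquares (count-legendreVector primes odds unique (λ σ → S? (-[1+ 0 ] ∷ σ)))) ⟩
  h * (c₊ * H) + h * (c₋ * H)
    ≡⟨ collect h c₊ c₋ H ⟩
  (c₊ + c₋) * (h * H)
    ≡⟨ cong (_* (h * H)) (count-signVectors S? (length ps)) ⟨
  count S? (signVectors (suc (length ps))) * (h * H) ∎
  where
  open ≡-Reasoning
  m = product ps
  h = p / 2
  H = halfProduct ps
  p∉ps : p ∉ ps
  p∉ps p∈ps = All.lookup p≢ps p∈ps refl
  open QuadraticResidues {h = h} p-prime (2∤⇒≡1+2*[/2] (≡1[mod2]⇒2∤ p-odd)) using (count-squares; count-nonsquares)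
  P? : Decidable _
  P? a = coprime? a (p * m) ×-dec S? (legendreVector (p ∷ ps) a)
  sign≡1? sign≡-1? : Decidable _
  sign≡1? a = legendre a p ℤ.≟ + 1
  sign≡-1? a = legendre a p ℤ.≟ -[1+ 0 ]
  B₊? B₋? : Decidable _
  B₊? c = coprime? c m ×-dec S? (+ 1 ∷ legendreVector ps c)
  B₋? c = coprime? c m ×-dec S? (-[1+ 0 ] ∷ legendreVector ps c)
  c₊ = count (λ σ → S? (+ 1 ∷ σ)) (signVectors (length ps))
  c₋ = count (λ σ → S? (-[1+ 0 ] ∷ σ)) (signVectors (length ps))
  sign≢1⇔sign≡-1 : count (P? ∩? ∁? sign≡1?) (upTo (p * m)) ≡ count (P? ∩? sign≡-1?) (upTo (p * m))
  sign≢1⇔sign≡-1 = count-cong _ _ (upTo (p * m))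
    (λ {a} _ ((a⊥pm , Sa) , leg≢1) → (a⊥pm , Sa) ,
       [ ⊥-elim ∘′ leg≢1 , id ]′ (legendre-sign p-prime {a} (coprime⇒∤ p-prime (coprime-*⁻ˡ a⊥pm))))
    (λ _ (Pa , leg≡-1) → Pa , λ leg≡1 → -1≢1 (trans (sym leg≡-1) leg≡1))

private
  product-step : ∀ s w k t → (1 + (1 + 2 * s) * (2 * w)) * (1 + (k + 2 * t) * (2 * w))
                             ≡ 1 + ((1 + k) + 2 * (t + s + (1 + 2 * s) * w * (k + 2 * t))) * (2 * w)
  product-step = ℕ-Solver.solve-∀

product-1+odd*2w : ∀ w qs → All (λ p → ∃[ s ] p ≡ 1 + (1 + 2 * s) * (2 * w)) qs →
                   ∃[ t ] product qs ≡ 1 + (length qs + 2 * t) * (2 * w)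
product-1+odd*2w w []       []                  = 0 , refl
product-1+odd*2w w (q ∷ qs) ((s , q≡) ∷ qs≡) =
  let t , Πqs≡ = product-1+odd*2w w qs qs≡ in
  t + s + (1 + 2 * s) * w * (length qs + 2 * t) ,
  trans (cong₂ _*_ q≡ Πqs≡) (product-step s w (length qs) t)

-- Euler liars of a Carmichael number with odd index

-- The gcd of A and 2B divides A, so misses the 2-part 2^j of 2B, hence divides B.
^≡1-half : ∀ {n} x A B j → x ℤ.^ A ≡ + 1 [mod n ] → x ℤ.^ (2 * B) ≡ + 1 [mod n ] →
           2 ^ j ∣ 2 * B → ¬ (2 ^ j ∣ A) → x ℤ.^ B ≡ + 1 [mod n ]
^≡1-half x A B j x^A≡1 x^2B≡1 2^j∣2B 2^j∤A = ^-≡1-∣ d∣B (^-≡1-gcd x A (2 * B) x^A≡1 x^2B≡1)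
  where
  d∣B : gcd A (2 * B) ∣ B
  d∣B = *-cancelˡ-∣ 2 (∣-2^j∣-2^j∤⇒2*∣ {j = j} (gcd[m,n]∣n A (2 * B)) 2^j∣2B (2^j∤A ∘′ (λ 2^j∣d → ∣-trans 2^j∣d (gcd[m,n]∣m A (2 * B)))))

select : Bool → ℤ → ℤ
select true  s = s
select false s = + 1

Agrees : List Bool → ℤ → List ℤ → Set
Agrees bs J σ = All (J ≡_) (zipWith select bs σ)

agrees? : ∀ bs J → Decidable (Agrees bs J)
agrees? bs J σ = All.all? (J ℤ.≟_) (zipWith select bs σ)

IsSign-* : ∀ {i j} → IsSign i → IsSign j → IsSign (i ℤ.* j)
IsSign-* (inj₁ refl) (inj₁ refl) = inj₁ refl
IsSign-* (inj₁ refl) (inj₂ refl) = inj₂ refl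
IsSign-* (inj₂ refl) (inj₁ refl) = inj₂ refl
IsSign-* (inj₂ refl) (inj₂ refl) = inj₁ refl

IsSign-prod : ∀ {σ} → All IsSign σ → IsSign (prod σ)
IsSign-prod []           = inj₁ refl
IsSign-prod (s± ∷ σ±) = IsSign-* s± (IsSign-prod σ±)

IsSign-select : ∀ b {s} → IsSign s → IsSign (select b s)
IsSign-select true  s± = s±
IsSign-select false _  = inj₁ refl

private
  zipWith-map-diagonal : ∀ {A B C D : Set} (f : B → C → D) (g : A → B) (k : A → C) xs →
                         zipWith f (map g xs) (map k xs) ≡ map (λ x → f (g x) (k x)) xs
  zipWith-map-diagonal f g k []       = refl
  zipWith-map-diagonal f g k (x ∷ xs) = cong (f (g x) (k x) ∷_) (zipWith-map-diagonal f g k xs)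

module OddIndexCarmichael {n : ℕ} {ps : List ℕ} {ℓ N : ℕ}
  (carmichael : Carmichael n) (primes : All Prime ps) (odds : All (λ p → Cong p 1 2) ps)
  (unique : Unique ps) (Πps≡n : product ps ≡ n) (lambda : IsCarmichaelLambda n ℓ)
  (oddIndex : OddIndex n ℓ) (v2 : IsV2 ℓ N) where

  private
    q : ℕ
    q = proj₁ oddIndex
    qℓ≡n-1 : q * ℓ ≡ n ∸ 1
    qℓ≡n-1 = proj₁ (proj₂ oddIndex)
    2∤q : ¬ (2 ∣ q)
    2∤q = ≡1[mod2]⇒2∤ (proj₂ (proj₂ oddIndex))
    0<n : 0 < n
    0<n = subst (0 <_) Πps≡n (productOfPrimes≥1 primes)
    instance
      n≢0 : NonZero n
      n≢0 = ℕ.>-nonZero 0<n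

    unit^[n-1]≡1 : ∀ {a} → Coprime a n → (+ a) ℤ.^ (n ∸ 1) ≡ + 1 [mod n ]
    unit^[n-1]≡1 {a} a⊥n = ≡[mod]-trans (≡⇒≡[mod] (sym (pos-^ a (n ∸ 1)))) (CongZ⇒≡[mod] (proj₂ carmichael a a⊥n))

    unit^ℓ≡1 : ∀ {a} → Coprime a n → (+ a) ℤ.^ ℓ ≡ + 1 [mod n ]
    unit^ℓ≡1 {a} a⊥n = ≡[mod]-trans (≡⇒≡[mod] (sym (pos-^ a ℓ))) (CongZ⇒≡[mod] (proj₂ (proj₁ lambda) a a⊥n))

  module AtPrime {p : ℕ} (p∈ps : p ∈ ps) where

    p-prime : Prime p
    p-prime = All.lookup primes p∈ps

    h : ℕ
    h = p / 2

    p≡1+2h : p ≡ suc (2 * h)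
    p≡1+2h = 2∤⇒≡1+2*[/2] (≡1[mod2]⇒2∤ (All.lookup odds p∈ps))

    p-1≡2h : p ∸ 1 ≡ 2 * h
    p-1≡2h = cong (_∸ 1) p≡1+2h

    open QuadraticResidues {h = h} p-prime p≡1+2h public

    private
      instance
        p≢0 : NonZero p
        p≢0 = prime⇒nonZero p-prime

    p∣n : p ∣ n
    p∣n = subst (p ∣_) Πps≡n (∈⇒∣product p∈ps)

    3≤p : 3 ≤ p
    3≤p = subst (3 ≤_) (sym p≡1+2h) (s≤s (ℕ.+-mono-≤ 1≤h (ℕ.≤-trans 1≤h (ℕ.m≤m+n h 0))))

    coprime⇒coprime-p : ∀ {a} → Coprime a n → Coprime a p
    coprime⇒coprime-p a⊥n (d∣a , d∣p) = a⊥n (d∣a , ∣-trans d∣p p∣n)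

    unit-lift : ∀ {b} → Coprime b p → ∃[ a ] (Coprime a n × + a ≡ + b [mod p ])
    unit-lift b⊥p =
      let m , Πps≡pm , p∤m = product-split primes unique p∈ps
          p⊥m = Coprime.sym (∤⇒coprime p-prime p∤m)
          instance
            m≢0 : NonZero m
            m≢0 = ℕ.m*n≢0⇒n≢0 p {{subst NonZero (trans (sym Πps≡n) Πps≡pm) n≢0}}
          a , a⊥pm , a≡b = ChineseRemainder.unit-lift p⊥m b⊥p
      in a , subst (Coprime a) (trans (sym Πps≡pm) Πps≡n) a⊥pm , a≡b

    private
      lift-≡1 : ∀ {b} E → (∀ {a} → Coprime a n → (+ a) ℤ.^ E ≡ + 1 [mod n ]) → Coprime b p → (+ b) ℤ.^ E ≡ + 1 [mod p ]
      lift-≡1 E units≡1 b⊥p = let a , a⊥n , a≡b = unit-lift b⊥p in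
        ≡[mod]-trans (^-cong-mod E (≡[mod]-sym a≡b)) (≡[mod]-divisor p∣n (units≡1 a⊥n))

    unit^[n-1]≡1[mod-p] : ∀ {b} → Coprime b p → (+ b) ℤ.^ (n ∸ 1) ≡ + 1 [mod p ]
    unit^[n-1]≡1[mod-p] = lift-≡1 (n ∸ 1) unit^[n-1]≡1

    unit^[p-1]≡1 : ∀ {b} → Coprime b p → (+ b) ℤ.^ (2 * h) ≡ + 1 [mod p ]
    unit^[p-1]≡1 {b} b⊥p = subst (λ k → (+ b) ℤ.^ k ≡ + 1 [mod p ]) p-1≡2h (fermat p-prime b (coprime⇒∤ p-prime b⊥p))

    2^[N+1]∤p-1 : ¬ (2 ^ suc N ∣ p ∸ 1)
    2^[N+1]∤p-1 2^N+1∣p-1 = nonsquare^h≢1 {g} g-nonsquare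
      (^≡1-half (+ g) ℓ h (suc N) (lift-≡1 ℓ unit^ℓ≡1 g⊥p) (unit^[p-1]≡1 g⊥p)
                (subst (2 ^ suc N ∣_) p-1≡2h 2^N+1∣p-1) (proj₂ v2))
      where
      nonsquare = count>0⇒∃ (hasLegendre? p -[1+ 0 ]) (upTo p) (subst (0 <_) (sym count-nonsquares) 1≤h)
      g = proj₁ nonsquare
      g⊥p = proj₁ (proj₂ (proj₂ nonsquare))
      g-nonsquare = proj₂ (proj₂ (proj₂ nonsquare))

  private
    someMember : ∃[ p ] p ∈ ps
    someMember = go Πps≡n
      where
      go : ∀ {xs} → product xs ≡ n → ∃[ p ] p ∈ xs
      go {[]}     1≡n = ⊥-elim (ℕ.nonTrivial⇒≢1 {{composite⇒nonTrivial (proj₁ carmichael)}} (sym 1≡n))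
      go {x ∷ xs} _   = x , here refl

  1≤N : 1 ≤ N
  1≤N = ℕ.n≢0⇒n>0 λ N≡0 → 2^[N+1]∤p-1 (subst (λ k → 2 ^ suc k ∣ p ∸ 1) (sym N≡0) 2∣p-1)
    where
    open AtPrime (proj₂ someMember)
    p = proj₁ someMember
    2∣p-1 : 2 ∣ p ∸ 1
    2∣p-1 = divides h (trans p-1≡2h (ℕ.*-comm 2 h))

  e : ℕ
  e = (n ∸ 1) / 2

  2e≡n-1 : 2 * e ≡ n ∸ 1
  2e≡n-1 = m*[n/m]≡n (subst (2 ∣_) qℓ≡n-1 (∣n⇒∣m*n q (∣-trans 2∣2^N (proj₁ v2))))
    where
    2∣2^N : 2 ∣ 2 ^ N
    2∣2^N = subst (λ k → 2 ∣ 2 ^ k) (ℕ.suc-pred N {{ℕ.>-nonZero 1≤N}}) (m∣m*n (2 ^ ℕ.pred N))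

  2^N∣2e : 2 ^ N ∣ 2 * e
  2^N∣2e = subst (2 ^ N ∣_) (trans qℓ≡n-1 (sym 2e≡n-1)) (∣n⇒∣m*n q (proj₁ v2))

  2^N∤e : ¬ (2 ^ N ∣ e)
  2^N∤e 2^N∣e = proj₂ v2 (2^j∣*2∤⇒2^j∣ (suc N) (subst (2 ^ suc N ∣_) 2e≡ℓq (*-monoʳ-∣ 2 2^N∣e)) 2∤q)
    where
    2e≡ℓq : 2 * e ≡ ℓ * q
    2e≡ℓq = trans 2e≡n-1 (trans (sym qℓ≡n-1) (ℕ.*-comm q ℓ))

  module _ {p : ℕ} (p∈ps : p ∈ ps) where

    open AtPrime p∈ps

    private
      ^2e≡1 : ∀ {b} → Coprime b p → (+ b) ℤ.^ (2 * e) ≡ + 1 [mod p ]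
      ^2e≡1 {b} b⊥p = subst (λ k → (+ b) ℤ.^ k ≡ + 1 [mod p ]) (sym 2e≡n-1) (unit^[n-1]≡1[mod-p] b⊥p)

      [^e]²≡1 : ∀ {b} → Coprime b p → (+ b) ℤ.^ e ℤ.* (+ b) ℤ.^ e ≡ + 1 [mod p ]
      [^e]²≡1 {b} b⊥p = ≡[mod]-trans (≡⇒≡[mod] (trans (sym (ℤ.^-distribˡ-+-* (+ b) e e))
                                                      (cong (λ k → (+ b) ℤ.^ (e + k)) (sym (ℕ.+-identityʳ e)))))
                                     (^2e≡1 b⊥p)

    square^e≡1 : ∀ {a} → Coprime a n → legendre a p ≡ + 1 → (+ a) ℤ.^ e ≡ + 1 [mod p ]
    square^e≡1 {a} a⊥n leg≡1 = begin
      (+ a) ℤ.^ e                ≈⟨ ^-cong-mod e (≡[mod]-sym x²≡a) ⟩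
      (+ (x * x)) ℤ.^ e          ≡⟨ cong (ℤ._^ e) (ℤ.pos-* x x) ⟩
      (+ x ℤ.* + x) ℤ.^ e        ≡⟨ ^-distribʳ-* (+ x) (+ x) e ⟩
      (+ x) ℤ.^ e ℤ.* (+ x) ℤ.^ e ≈⟨ [^e]²≡1 x⊥p ⟩
      + 1                        ∎
      where
      open ≡[mod]-Reasoning p
      square = legendre≡1⇒square p-prime {a} leg≡1
      x = proj₁ square
      x²≡a = proj₂ (proj₂ square)
      x⊥p : Coprime x p
      x⊥p = ∤⇒coprime p-prime λ p∣x → coprime⇒∤ p-prime (coprime⇒coprime-p a⊥n)
              (∣-resp-≡[mod] ∣-refl x²≡a (∣n⇒∣m*n x p∣x))

    nonsquare^e≡-1 : ∀ {a} → IsV2 (p ∸ 1) N → Coprime a n → legendre a p ≡ -[1+ 0 ] → (+ a) ℤ.^ e ≡ -[1+ 0 ] [mod p ]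
    nonsquare^e≡-1 {a} (2^N∣p-1 , _) a⊥n leg≡-1 = [ ⊥-elim ∘′ a^e≢1 , id ]′ (square≡1⇒±1 p-prime ((+ a) ℤ.^ e) ([^e]²≡1 a⊥p))
      where
      a⊥p = coprime⇒coprime-p a⊥n
      a^e≢1 : ¬ ((+ a) ℤ.^ e ≡ + 1 [mod p ])
      a^e≢1 a^e≡1 = nonsquare^h≢1 {a} leg≡-1
        (^≡1-half (+ a) e h N a^e≡1 (unit^[p-1]≡1 a⊥p) (subst (2 ^ N ∣_) p-1≡2h 2^N∣p-1) 2^N∤e)

    unbalanced^e≡1 : ∀ {a} → ¬ IsV2 (p ∸ 1) N → Coprime a n → (+ a) ℤ.^ e ≡ + 1 [mod p ]
    unbalanced^e≡1 {a} ¬v2 a⊥n = ^≡1-half (+ a) (2 * h) e N (unit^[p-1]≡1 a⊥p) (^2e≡1 a⊥p) 2^N∣2e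
      (λ 2^N∣2h → ¬v2 (subst (2 ^ N ∣_) (sym p-1≡2h) 2^N∣2h , 2^[N+1]∤p-1))
      where
      a⊥p = coprime⇒coprime-p a⊥n

    euler-power : ∀ {a} → Coprime a n → (+ a) ℤ.^ e ≡ select (does (isV2? N (p ∸ 1))) (legendre a p) [mod p ]
    euler-power {a} a⊥n = byCase (isV2? N (p ∸ 1))
      where
      byCase : (v2? : Dec (IsV2 (p ∸ 1) N)) → (+ a) ℤ.^ e ≡ select (does v2?) (legendre a p) [mod p ]
      byCase (no ¬v2) = unbalanced^e≡1 ¬v2 a⊥n
      byCase (yes v2′) = [ (λ leg≡1 → ≡[mod]-trans (square^e≡1 a⊥n leg≡1) (≡⇒≡[mod] (sym leg≡1)))
                         , (λ leg≡-1 → ≡[mod]-trans (nonsquare^e≡-1 v2′ a⊥n leg≡-1) (≡⇒≡[mod] (sym leg≡-1))) ]′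
                         (legendre-sign p-prime {a} (coprime⇒∤ p-prime (coprime⇒coprime-p a⊥n)))

  mask : List Bool
  mask = map (λ p → does (isV2? N (p ∸ 1))) ps

  jacobi≡prod-legendreVector : ∀ a → jacobi a n ≡ prod (legendreVector ps a)
  jacobi≡prod-legendreVector a = subst (λ m → jacobi a m ≡ prod (legendreVector ps a)) Πps≡n (jacobi-squarefree a primes unique)

  private
    Agrees-mask⁺ : ∀ {a J} → (∀ {p} → p ∈ ps → J ≡ select (does (isV2? N (p ∸ 1))) (legendre a p)) →
                   Agrees mask J (legendreVector ps a)
    Agrees-mask⁺ {a} {J} agree = subst (All (J ≡_)) (sym (zipWith-map-diagonal select _ _ ps)) (All.map⁺ (All.tabulate agree))

    Agrees-mask⁻ : ∀ {a J p} → Agrees mask J (legendreVector ps a) → p ∈ ps →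
                   J ≡ select (does (isV2? N (p ∸ 1))) (legendre a p)
    Agrees-mask⁻ {a} {J} agrees = All.lookup (All.map⁻ (subst (All (J ≡_)) (zipWith-map-diagonal select _ _ ps) agrees))

    legendreVector-signs : ∀ {a} → Coprime a n → All IsSign (legendreVector ps a)
    legendreVector-signs a⊥n = All.map⁺ (All.tabulate λ p∈ →
      legendre-sign (All.lookup primes p∈) (coprime⇒∤ (All.lookup primes p∈) (AtPrime.coprime⇒coprime-p p∈ a⊥n)))

  eulerLiar⇒agrees : ∀ {a} → EulerLiar n a → Coprime a n × Agrees mask (prod (legendreVector ps a)) (legendreVector ps a)
  eulerLiar⇒agrees {a} ((_ , a⊥n) , J≡a^e) = a⊥n , Agrees-mask⁺ λ {p} p∈ps →
    IsSign-≡[mod] (AtPrime.3≤p p∈ps) (IsSign-prod (legendreVector-signs a⊥n))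
      (IsSign-select (does (isV2? N (p ∸ 1))) (All.lookup (All.map⁻ (legendreVector-signs a⊥n)) p∈ps))
      (≡[mod]-trans (≡[mod]-divisor (AtPrime.p∣n p∈ps) J≡a^e′) (euler-power p∈ps a⊥n))
    where
    J≡a^e′ : prod (legendreVector ps a) ≡ (+ a) ℤ.^ e [mod n ]
    J≡a^e′ = ≡[mod]-trans (≡⇒≡[mod] (sym (jacobi≡prod-legendreVector a)))
               (≡[mod]-trans (CongZ⇒≡[mod] J≡a^e) (≡⇒≡[mod] (pos-^ a e)))

  agrees⇒eulerLiar : ∀ {a} → a < n → Coprime a n → Agrees mask (prod (legendreVector ps a)) (legendreVector ps a) →
                     EulerLiar n a
  agrees⇒eulerLiar {a} a<n a⊥n agrees = (a<n , a⊥n) , ≡[mod]⇒CongZ (begin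
    jacobi a n                  ≡⟨ jacobi≡prod-legendreVector a ⟩
    prod (legendreVector ps a)  ≈⟨ mod-divides (∣ᵤ⇒∣ n∣J-a^e) ⟩
    (+ a) ℤ.^ e                 ≡⟨ pos-^ a e ⟨
    + (a ^ e)                   ∎)
    where
    open ≡[mod]-Reasoning n
    J-a^e = prod (legendreVector ps a) ℤ.- (+ a) ℤ.^ e
    p∣J-a^e : ∀ {p} → p ∈ ps → p ∣ ℤ.∣ prod (legendreVector ps a) ℤ.- (+ a) ℤ.^ e ∣
    p∣J-a^e p∈ps = ∣⇒∣ᵤ (divides-difference
      (≡[mod]-trans (≡⇒≡[mod] (Agrees-mask⁻ agrees p∈ps)) (≡[mod]-sym (euler-power p∈ps a⊥n))))
    n∣J-a^e : n ∣ ℤ.∣ J-a^e ∣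
    n∣J-a^e = subst (_∣ ℤ.∣ J-a^e ∣) Πps≡n (product-∣ primes unique p∣J-a^e)

  private
    count-units-by-legendreVector : ∀ {S : List ℤ → Set} (S? : Decidable S) →
      count (λ a → coprime? a n ×-dec S? (legendreVector ps a)) (upTo n) ≡ count S? (signVectors (length ps)) * halfProduct ps
    count-units-by-legendreVector {S} S? =
      subst (λ m → count (λ a → coprime? a m ×-dec S? (legendreVector ps a)) (upTo m) ≡ _) Πps≡n
            (count-legendreVector primes odds unique S?)

    LiarVector : List ℤ → Set
    LiarVector σ = Agrees mask (prod σ) σ

    liarVector? : Decidable LiarVector
    liarVector? σ = agrees? mask (prod σ) σ

  numLiars≡ : numLiars n ≡ count liarVector? (signVectors (length ps)) * halfProduct ps
  numLiars≡ = trans (count-cong (eulerLiar? n) (λ a → coprime? a n ×-dec liarVector? (legendreVector ps a)) (upTo n)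
                       (λ _ → eulerLiar⇒agrees) (λ a∈ (a⊥n , agrees) → agrees⇒eulerLiar (∈-upTo⁻ a∈) a⊥n agrees))
                    (count-units-by-legendreVector liarVector?)

  numLiarsWithJacobi≡ : ∀ j → numLiarsWithJacobi n j ≡
    count (λ σ → liarVector? σ ×-dec (prod σ ℤ.≟ j)) (signVectors (length ps)) * halfProduct ps
  numLiarsWithJacobi≡ j = trans
    (count-cong _ (λ a → coprime? a n ×-dec (liarVector? (legendreVector ps a) ×-dec (prod (legendreVector ps a) ℤ.≟ j))) (upTo n)
      (λ {a} _ (liar , J≡j) → let a⊥n , agrees = eulerLiar⇒agrees liar in
        a⊥n , agrees , trans (sym (jacobi≡prod-legendreVector a)) J≡j)
      (λ {a} a∈ (a⊥n , agrees , J≡j) → agrees⇒eulerLiar (∈-upTo⁻ a∈) a⊥n agrees , trans (jacobi≡prod-legendreVector a) J≡j))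
    (count-units-by-legendreVector (λ σ → liarVector? σ ×-dec (prod σ ℤ.≟ j)))

  φ≡ : φ n ≡ 2 ^ length ps * halfProduct ps
  φ≡ = trans (count-cong (λ a → coprime? a n) (λ a → coprime? a n ×-dec any? (legendreVector ps a)) (upTo n)
                (λ _ a⊥n → a⊥n , tt) (λ _ → proj₁))
        (trans (count-units-by-legendreVector any?)
               (cong (_* halfProduct ps) (trans (count-all any? {signVectors (length ps)} (All.universal (λ _ → tt) _)) (length-signVectors (length ps)))))
    where
    any? : Decidable {A = List ℤ} (λ _ → ⊤)
    any? _ = yes tt

  -- (n - 1)/2^N ≡ k (mod 2) by the product formula, while (n - 1)/2^N = q · (ℓ/2^N) is odd.
  allBalanced⇒2∤length : All (λ p → IsV2 (p ∸ 1) N) ps → ¬ (2 ∣ length ps)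
  allBalanced⇒2∤length balanced = 2∤-+2* {length ps} {t} (subst (λ x → ¬ (2 ∣ x)) (sym k+2t≡qM) (2∤-* 2∤q 2∤M))
    where
    w = 2 ^ ℕ.pred N
    2^N≡2w : 2 ^ N ≡ 2 * w
    2^N≡2w = cong (2 ^_) (sym (ℕ.suc-pred N {{ℕ.>-nonZero 1≤N}}))
    ℓ-oddPart = IsV2⇒oddPart {ℓ} {N} v2
    M = proj₁ ℓ-oddPart
    2∤M = proj₁ (proj₂ ℓ-oddPart)
    ℓ≡M2w : ℓ ≡ M * (2 * w)
    ℓ≡M2w = trans (proj₂ (proj₂ ℓ-oddPart)) (cong (M *_) 2^N≡2w)
    shape : ∀ {p} → p ∈ ps → ∃[ s ] p ≡ 1 + (1 + 2 * s) * (2 * w)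
    shape {p} p∈ =
      let u , 2∤u , p-1≡u2^N = IsV2⇒oddPart {p ∸ 1} {N} (All.lookup balanced p∈) in
      u / 2 , (begin
        p                       ≡⟨ ℕ.suc-pred p {{prime⇒nonZero (All.lookup primes p∈)}} ⟨
        suc (p ∸ 1)             ≡⟨ cong suc p-1≡u2^N ⟩
        suc (u * 2 ^ N)         ≡⟨ cong₂ (λ x y → suc (x * y)) (2∤⇒≡1+2*[/2] 2∤u) 2^N≡2w ⟩
        1 + (1 + 2 * (u / 2)) * (2 * w) ∎)
      where open ≡-Reasoning
    t = proj₁ (product-1+odd*2w w ps (All.tabulate shape))
    Πps≡ = proj₂ (product-1+odd*2w w ps (All.tabulate shape))
    k+2t≡qM : length ps + 2 * t ≡ q * M
    k+2t≡qM = ℕ.*-cancelʳ-≡ _ _ (2 * w) {{ℕ.m*n≢0 2 w {{_}} {{ℕ.m^n≢0 2 (ℕ.pred N)}}}} (begin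
      (length ps + 2 * t) * (2 * w)   ≡⟨ cong (_∸ 1) (trans (sym Πps≡) Πps≡n) ⟩
      n ∸ 1                          ≡⟨ qℓ≡n-1 ⟨
      q * ℓ                          ≡⟨ cong (q *_) ℓ≡M2w ⟩
      q * (M * (2 * w))              ≡⟨ ℕ.*-assoc q M (2 * w) ⟨
      q * M * (2 * w)                ∎)
      where open ≡-Reasoning

-- Counting admissible sign vectors

∈-signVectors⁻ : ∀ {k σ} → σ ∈ signVectors k → length σ ≡ k × All IsSign σ
∈-signVectors⁻ {zero}  (here refl) = refl , []
∈-signVectors⁻ {suc k} σ∈ with ∈-++⁻ (map (+ 1 ∷_) (signVectors k)) σ∈
... | inj₁ σ∈₊ = let τ , τ∈ , σ≡ = ∈-map⁻ (+ 1 ∷_) σ∈₊ ; len≡ , τ± = ∈-signVectors⁻ τ∈ in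
  subst (λ σ → length σ ≡ suc k × All IsSign σ) (sym σ≡) (cong suc len≡ , inj₁ refl ∷ τ±)
... | inj₂ σ∈₋ = let τ , τ∈ , σ≡ = ∈-map⁻ (-[1+ 0 ] ∷_) σ∈₋ ; len≡ , τ± = ∈-signVectors⁻ τ∈ in
  subst (λ σ → length σ ≡ suc k × All IsSign σ) (sym σ≡) (cong suc len≡ , inj₂ refl ∷ τ±)

count-constant : ∀ {j} → IsSign j → ∀ k → count (λ σ → All.all? (ℤ._≟ j) σ) (signVectors k) ≡ 1
count-constant j± zero    = refl
count-constant {j} j± (suc k) = trans (count-signVectors (λ σ → All.all? (ℤ._≟ j) σ) k) (bySign j±)
  where
  head≡ : ∀ s → s ≡ j → count (λ σ → All.all? (ℤ._≟ j) (s ∷ σ)) (signVectors k) ≡ 1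
  head≡ s s≡j = trans (count-cong _ (λ σ → All.all? (ℤ._≟ j) σ) (signVectors k) (λ _ → All.tail) (λ _ → s≡j ∷_))
                      (count-constant j± k)
  head≢ : ∀ s → s ≢ j → count (λ σ → All.all? (ℤ._≟ j) (s ∷ σ)) (signVectors k) ≡ 0
  head≢ s s≢j = count-none (λ σ → All.all? (ℤ._≟ j) (s ∷ σ)) {signVectors k} (All.universal (λ _ all≡j → s≢j (All.head all≡j)) _)
  bySign : IsSign j → count (λ σ → All.all? (ℤ._≟ j) (+ 1 ∷ σ)) (signVectors k) + count (λ σ → All.all? (ℤ._≟ j) (-[1+ 0 ] ∷ σ)) (signVectors k) ≡ 1
  bySign (inj₁ refl) = cong₂ _+_ (head≡ (+ 1) refl) (head≢ -[1+ 0 ] -1≢1)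
  bySign (inj₂ refl) = cong₂ _+_ (head≢ (+ 1) (-1≢1 ∘′ sym)) (head≡ -[1+ 0 ] refl)

private
  prod-replicate : ∀ {j σ} → All (_≡ j) σ → prod σ ≡ j ℤ.^ length σ
  prod-replicate []           = refl
  prod-replicate (s≡j ∷ σ≡j) = cong₂ ℤ._*_ s≡j (prod-replicate σ≡j)

  sign^odd : ∀ {j} → IsSign j → ∀ s → j ℤ.^ suc (2 * s) ≡ j
  sign^odd {j} j± s = begin
    j ℤ.* j ℤ.^ (2 * s)     ≡⟨ cong (j ℤ.*_) (ℤ.^-*-assoc j 2 s) ⟨
    j ℤ.* (j ℤ.^ 2) ℤ.^ s   ≡⟨ cong (λ x → j ℤ.* x ℤ.^ s) (j^2≡1 j±) ⟩
    j ℤ.* (+ 1) ℤ.^ s       ≡⟨ cong (j ℤ.*_) (ℤ.^-zeroˡ s) ⟩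
    j ℤ.* + 1               ≡⟨ ℤ.*-identityʳ j ⟩
    j                       ∎
    where
    open ≡-Reasoning
    j^2≡1 : ∀ {j} → IsSign j → j ℤ.^ 2 ≡ + 1
    j^2≡1 (inj₁ refl) = refl
    j^2≡1 (inj₂ refl) = refl

prod-constant : ∀ {j σ} → IsSign j → All (_≡ j) σ → ¬ (2 ∣ length σ) → prod σ ≡ j
prod-constant {j} {σ} j± σ≡j 2∤len =
  trans (prod-replicate σ≡j) (trans (cong (j ℤ.^_) (2∤⇒≡1+2*[/2] 2∤len)) (sign^odd j± (length σ / 2)))

Agrees-allTrue : ∀ {bs J σ} → All (_≡ true) bs → length σ ≡ length bs → Agrees bs J σ → All (_≡ J) σ
Agrees-allTrue {[]}     {σ = []}    _            _       _              = []
Agrees-allTrue {b ∷ bs} {σ = s ∷ σ} (refl ∷ bs≡) len≡ (J≡s ∷ agrees) =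
  sym J≡s ∷ Agrees-allTrue bs≡ (ℕ.suc-injective len≡) agrees

allTrue-Agrees : ∀ {bs J σ} → All (_≡ true) bs → length σ ≡ length bs → All (_≡ J) σ → Agrees bs J σ
allTrue-Agrees {[]}     {σ = []}    _            _    _           = []
allTrue-Agrees {b ∷ bs} {σ = s ∷ σ} (refl ∷ bs≡) len≡ (s≡J ∷ σ≡J) =
  sym s≡J ∷ allTrue-Agrees bs≡ (ℕ.suc-injective len≡) σ≡J

Agrees-false⇒≡1 : ∀ {bs J σ} → false ∈ bs → length σ ≡ length bs → Agrees bs J σ → J ≡ + 1
Agrees-false⇒≡1 {b ∷ bs} {σ = s ∷ σ} (here refl) _    (J≡1 ∷ _)      = J≡1
Agrees-false⇒≡1 {b ∷ bs} {σ = s ∷ σ} (there f∈) len≡ (_ ∷ agrees) = Agrees-false⇒≡1 f∈ (ℕ.suc-injective len≡) agrees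

freeSigns : List Bool → ℤ → ℕ
freeSigns bs t = count (λ σ → agrees? bs (+ 1) σ ×-dec (prod σ ℤ.≟ t)) (signVectors (length bs))

#false : List Bool → ℕ
#false = count (Bool._≟ false)

private
  freeSigns₊ : ∀ b bs t → count (λ τ → agrees? (b ∷ bs) (+ 1) (+ 1 ∷ τ) ×-dec (prod (+ 1 ∷ τ) ℤ.≟ t)) (signVectors (length bs))
                          ≡ freeSigns bs t
  freeSigns₊ b bs t = count-cong _ _ (signVectors (length bs))
    (λ _ → λ { ((_ ∷ agrees) , 1*prod≡t) → agrees , trans (sym (ℤ.*-identityˡ _)) 1*prod≡t })
    (λ _ (agrees , prod≡t) → (sym (select-1 b) ∷ agrees) , trans (ℤ.*-identityˡ _) prod≡t)
    where
    select-1 : ∀ b → select b (+ 1) ≡ + 1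
    select-1 true  = refl
    select-1 false = refl

freeSigns-true : ∀ bs t → freeSigns (true ∷ bs) t ≡ freeSigns bs t
freeSigns-true bs t = begin
  freeSigns (true ∷ bs) t                    ≡⟨ count-signVectors (λ σ → agrees? (true ∷ bs) (+ 1) σ ×-dec (prod σ ℤ.≟ t)) (length bs) ⟩
  count _ (signVectors (length bs)) + count _ (signVectors (length bs)) ≡⟨ cong₂ _+_ (freeSigns₊ true bs t) none₋ ⟩
  freeSigns bs t + 0                         ≡⟨ ℕ.+-identityʳ _ ⟩
  freeSigns bs t                             ∎
  where
  open ≡-Reasoning
  none₋ : count (λ τ → agrees? (true ∷ bs) (+ 1) (-[1+ 0 ] ∷ τ) ×-dec (prod (-[1+ 0 ] ∷ τ) ℤ.≟ t)) (signVectors (length bs)) ≡ 0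
  none₋ = count-none _ {signVectors (length bs)} (All.universal (λ _ → λ { ((1≡-1 ∷ _) , _) → -1≢1 (sym 1≡-1) }) _)

freeSigns-false : ∀ bs t → freeSigns (false ∷ bs) t ≡ freeSigns bs t + freeSigns bs (ℤ.- t)
freeSigns-false bs t = trans (count-signVectors (λ σ → agrees? (false ∷ bs) (+ 1) σ ×-dec (prod σ ℤ.≟ t)) (length bs))
  (cong₂ _+_ (freeSigns₊ false bs t) (count-cong _ _ (signVectors (length bs))
    (λ _ → λ { ((_ ∷ agrees) , -prod≡t) → agrees , trans (sym (ℤ.neg-involutive _)) (cong ℤ.-_ (trans (sym (ℤ.-1*i≡-i _)) -prod≡t)) })
    (λ _ (agrees , prod≡-t) → (refl ∷ agrees) , trans (ℤ.-1*i≡-i _) (trans (cong ℤ.-_ prod≡-t) (ℤ.neg-involutive t)))))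

freeSigns-allTrue : ∀ {bs} → All (_≡ true) bs → freeSigns bs (+ 1) ≡ 1 × freeSigns bs -[1+ 0 ] ≡ 0
freeSigns-allTrue {[]}      []            = refl , refl
freeSigns-allTrue {b ∷ bs} (refl ∷ bs≡) =
  let ones , minus = freeSigns-allTrue bs≡ in
  trans (freeSigns-true bs (+ 1)) ones , trans (freeSigns-true bs -[1+ 0 ]) minus

-- On the positions where bs is false the signs are free, subject only to their product being t.
freeSigns*2 : ∀ {bs t} → false ∈ bs → IsSign t → freeSigns bs t * 2 ≡ 2 ^ #false bs
freeSigns*2 {true ∷ bs} {t} (there f∈) t± = trans (cong (_* 2) (freeSigns-true bs t)) (freeSigns*2 f∈ t±)
freeSigns*2 {false ∷ bs} {t} _ t± = trans (cong (_* 2) (freeSigns-false bs t)) (byRest (Any.any? (false Bool.≟_) bs))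
  where
  neg-sign : ∀ {t} → IsSign t → IsSign (ℤ.- t)
  neg-sign (inj₁ refl) = inj₂ refl
  neg-sign (inj₂ refl) = inj₁ refl
  byRest : Dec (false ∈ bs) → (freeSigns bs t + freeSigns bs (ℤ.- t)) * 2 ≡ 2 ^ suc (#false bs)
  byRest (yes f∈) = begin
    (freeSigns bs t + freeSigns bs (ℤ.- t)) * 2     ≡⟨ ℕ.*-distribʳ-+ 2 (freeSigns bs t) _ ⟩
    freeSigns bs t * 2 + freeSigns bs (ℤ.- t) * 2  ≡⟨ cong₂ _+_ (freeSigns*2 f∈ t±) (freeSigns*2 f∈ (neg-sign t±)) ⟩
    2 ^ #false bs + 2 ^ #false bs                   ≡⟨ cong (λ x → 2 ^ #false bs + x) (ℕ.+-identityʳ _) ⟨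
    2 ^ suc (#false bs)                             ∎
    where open ≡-Reasoning
  byRest (no f∉) = trans (cong (_* 2) (oneOfTwo t±)) (cong (λ f → 2 ^ suc f) (sym (count-none (Bool._≟ false) noFalse)))
    where
    ≢false⇒≡true : ∀ {b} → false ≢ b → b ≡ true
    ≢false⇒≡true {true}  _   = refl
    ≢false⇒≡true {false} f≢f = ⊥-elim (f≢f refl)
    noFalse : All (λ b → b ≢ false) bs
    noFalse = All.map (λ f≢b b≡f → f≢b (sym b≡f)) (All.¬Any⇒All¬ bs f∉)
    allTrue : All (_≡ true) bs
    allTrue = All.map (λ b≢f → ≢false⇒≡true (b≢f ∘′ sym)) noFalse
    oneOfTwo : IsSign t → freeSigns bs t + freeSigns bs (ℤ.- t) ≡ 1
    oneOfTwo (inj₁ refl) = let ones , minus = freeSigns-allTrue allTrue in cong₂ _+_ ones minus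
    oneOfTwo (inj₂ refl) = let ones , minus = freeSigns-allTrue allTrue in cong₂ _+_ minus ones

module _ {P : A → Set ℓ₁} (P? : Decidable P) where

  count+#false : ∀ xs → count P? xs + #false (map (λ x → does (P? x)) xs) ≡ length xs
  count+#false []       = refl
  count+#false (x ∷ xs) with P? x
  ... | yes _ = cong suc (count+#false xs)
  ... | no  _ = trans (ℕ.+-suc _ _) (cong suc (count+#false xs))

  count<length⇒false∈ : ∀ xs → count P? xs < length xs → false ∈ map (λ x → does (P? x)) xs
  count<length⇒false∈ (x ∷ xs) count<length with P? x
  ... | yes _ = there (count<length⇒false∈ xs (ℕ.≤-pred count<length))
  ... | no  _ = here refl

  All⇒allTrue : ∀ {xs} → All P xs → All (_≡ true) (map (λ x → does (P? x)) xs)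
  All⇒allTrue []          = []
  All⇒allTrue {x ∷ _} (Px ∷ Pxs) = dec-true (P? x) Px ∷ All⇒allTrue Pxs

-- Counting Euler liars

module LiarCounts {n : ℕ} {ps : List ℕ} {ℓ N : ℕ}
  (carmichael : Carmichael n) (primes : All Prime ps) (odds : All (λ p → Cong p 1 2) ps)
  (unique : Unique ps) (Πps≡n : product ps ≡ n) (lambda : IsCarmichaelLambda n ℓ)
  (oddIndex : OddIndex n ℓ) (v2 : IsV2 ℓ N) where

  open OddIndexCarmichael {N = N} carmichael primes odds unique Πps≡n lambda oddIndex v2

  private
    h = countL (λ p → isV2? N (p ∸ 1)) ps
    k = length ps
    H = halfProduct ps

    length-mask : length mask ≡ k
    length-mask = length-map _ ps

    rearrange : ∀ c H x → c * H * (x * 2) ≡ c * 2 * x * H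
    rearrange = ℕ-Solver.solve-∀

    swap : ∀ H x → 2 * H * x ≡ 2 * x * H
    swap = ℕ-Solver.solve-∀

    liarVector⇒length : ∀ {σ} → σ ∈ signVectors k → length σ ≡ length mask
    liarVector⇒length σ∈ = trans (proj₁ (∈-signVectors⁻ σ∈)) (sym length-mask)

  module _ (h<k : h < k) where

    private
      false∈mask : false ∈ mask
      false∈mask = count<length⇒false∈ (λ p → isV2? N (p ∸ 1)) ps h<k

      liarVector⇔free : count (λ σ → agrees? mask (prod σ) σ) (signVectors k) ≡ freeSigns mask (+ 1)
      liarVector⇔free = trans
        (count-cong _ (λ σ → agrees? mask (+ 1) σ ×-dec (prod σ ℤ.≟ + 1)) (signVectors k)
          (λ {σ} σ∈ agrees → let J≡1 = Agrees-false⇒≡1 false∈mask (liarVector⇒length σ∈) agrees in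
                             subst (λ J → Agrees mask J σ) J≡1 agrees , J≡1)
          (λ {σ} _ (agrees , J≡1) → subst (λ J → Agrees mask J σ) (sym J≡1) agrees))
        (cong (λ k → count (λ σ → agrees? mask (+ 1) σ ×-dec (prod σ ℤ.≟ + 1)) (signVectors k)) (sym length-mask))

    liars-unbalanced : numLiars n * 2 ^ (h + 1) ≡ φ n
    liars-unbalanced = begin
      numLiars n * 2 ^ (h + 1)              ≡⟨ cong₂ _*_ (trans numLiars≡ (cong (_* H) liarVector⇔free)) (ℕ.^-distribˡ-+-* 2 h 1) ⟩
      F * H * (2 ^ h * 2)                   ≡⟨ rearrange F H (2 ^ h) ⟩
      F * 2 * 2 ^ h * H                     ≡⟨ cong (λ x → x * 2 ^ h * H) (freeSigns*2 false∈mask (inj₁ refl)) ⟩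
      2 ^ #false mask * 2 ^ h * H           ≡⟨ cong (_* H) (ℕ.^-distribˡ-+-* 2 (#false mask) h) ⟨
      2 ^ (#false mask + h) * H             ≡⟨ cong (λ e → 2 ^ e * H) #false+h≡k ⟩
      2 ^ k * H                             ≡⟨ φ≡ ⟨
      φ n                                   ∎
      where
      open ≡-Reasoning
      F = freeSigns mask (+ 1)
      #false+h≡k : #false mask + h ≡ k
      #false+h≡k = trans (ℕ.+-comm (#false mask) h) (count+#false (λ p → isV2? N (p ∸ 1)) ps)

    jacobi-unbalanced : ∀ a → EulerLiar n a → jacobi a n ≡ + 1
    jacobi-unbalanced a liar = trans (jacobi≡prod-legendreVector a)
      (Agrees-false⇒≡1 false∈mask (trans (length-map _ ps) (sym length-mask)) (proj₂ (eulerLiar⇒agrees liar)))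

  module _ (h≡k : h ≡ k) where

    private
      balanced : All (λ p → IsV2 (p ∸ 1) N) ps
      balanced = count≡length⇒All (λ p → isV2? N (p ∸ 1)) ps h≡k

      allTrue : All (_≡ true) mask
      allTrue = All⇒allTrue (λ p → isV2? N (p ∸ 1)) balanced

      2∤k : ¬ (2 ∣ k)
      2∤k = allBalanced⇒2∤length balanced

      liarVectors-with : ∀ {j} → IsSign j → count (λ σ → agrees? mask (prod σ) σ ×-dec (prod σ ℤ.≟ j)) (signVectors k) ≡ 1
      liarVectors-with {j} j± = trans (count-cong _ (λ σ → All.all? (ℤ._≟ j) σ) (signVectors k)
          (λ {σ} σ∈ (agrees , J≡j) → subst (λ J → All (_≡ J) σ) J≡j (Agrees-allTrue allTrue (liarVector⇒length σ∈) agrees))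
          (λ {σ} σ∈ σ≡j → let J≡j = prod-constant j± σ≡j (subst (λ l → ¬ (2 ∣ l)) (sym (proj₁ (∈-signVectors⁻ σ∈))) 2∤k) in
             subst (λ J → Agrees mask J σ) (sym J≡j) (allTrue-Agrees allTrue (liarVector⇒length σ∈) σ≡j) , J≡j))
        (count-constant j± k)

      liarsWithJacobi≡H : ∀ {j} → IsSign j → numLiarsWithJacobi n j ≡ H
      liarsWithJacobi≡H {j} j± = trans (numLiarsWithJacobi≡ j) (trans (cong (_* H) (liarVectors-with j±)) (ℕ.*-identityˡ H))

    liars-balanced : numLiars n * 2 ^ (k ∸ 1) ≡ φ n
    liars-balanced = begin
      numLiars n * 2 ^ (k ∸ 1)        ≡⟨ cong (_* 2 ^ (k ∸ 1)) (trans numLiars≡ (cong (_* H) liarVectors≡2)) ⟩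
      2 * H * 2 ^ (k ∸ 1)             ≡⟨ swap H (2 ^ (k ∸ 1)) ⟩
      2 * 2 ^ (k ∸ 1) * H             ≡⟨ cong (λ e → 2 ^ e * H) (ℕ.suc-pred k {{ℕ.>-nonZero (ℕ.n≢0⇒n>0 k≢0)}}) ⟩
      2 ^ k * H                       ≡⟨ φ≡ ⟨
      φ n                             ∎
      where
      open ≡-Reasoning
      k≢0 : k ≢ 0
      k≢0 k≡0 = 2∤k (subst (2 ∣_) (sym k≡0) (2 ∣0))
      liar? = λ σ → agrees? mask (prod σ) σ
      liarVectors≡2 : count liar? (signVectors k) ≡ 2
      liarVectors≡2 = begin
        count liar? (signVectors k)
          ≡⟨ count-split liar? (λ σ → prod σ ℤ.≟ + 1) (signVectors k) ⟩
        count (liar? ∩? (λ σ → prod σ ℤ.≟ + 1)) (signVectors k) + count (liar? ∩? ∁? (λ σ → prod σ ℤ.≟ + 1)) (signVectors k)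
          ≡⟨ cong₂ _+_ (liarVectors-with (inj₁ refl)) (trans J≢1⇔J≡-1 (liarVectors-with (inj₂ refl))) ⟩
        2 ∎
        where
        J≢1⇔J≡-1 : count (liar? ∩? ∁? (λ σ → prod σ ℤ.≟ + 1)) (signVectors k)
                   ≡ count (λ σ → liar? σ ×-dec (prod σ ℤ.≟ -[1+ 0 ])) (signVectors k)
        J≢1⇔J≡-1 = count-cong _ _ (signVectors k)
          (λ σ∈ (agrees , J≢1) → agrees , [ ⊥-elim ∘′ J≢1 , id ]′ (IsSign-prod (proj₂ (∈-signVectors⁻ {k} σ∈))))
          (λ _ (agrees , J≡-1) → agrees , λ J≡1 → -1≢1 (trans (sym J≡-1) J≡1))

    jacobi-balanced : numLiarsWithJacobi n (+ 1) ≡ numLiarsWithJacobi n -[1+ 0 ]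
    jacobi-balanced = trans (liarsWithJacobi≡H (inj₁ refl)) (sym (liarsWithJacobi≡H (inj₂ refl)))

mainTheorem3 : (n : ℕ) (ps : List ℕ) (ℓ N : ℕ)
    → Carmichael n
    → All Prime ps → All (λ p → Cong p 1 2) ps → Unique ps → product ps ≡ n
    → IsCarmichaelLambda n ℓ
    → OddIndex n ℓ
    → IsV2 ℓ N
    → ((1 ≤ countL (λ p → isV2? N (p ∸ 1)) ps
        → countL (λ p → isV2? N (p ∸ 1)) ps < length ps
        → (numLiars n * 2 ^ (countL (λ p → isV2? N (p ∸ 1)) ps + 1) ≡ φ n)
          × (∀ a → EulerLiar n a → jacobi a n ≡ + 1))
      × (countL (λ p → isV2? N (p ∸ 1)) ps ≡ length ps
        → (numLiars n * 2 ^ (length ps ∸ 1) ≡ φ n)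
          × (numLiarsWithJacobi n (+ 1) ≡ numLiarsWithJacobi n -[1+ 0 ])))
mainTheorem3 n ps ℓ N carmichael primes odds unique Πps≡n lambda oddIndex v2 =
  -- Case (1) holds as soon as h < k.
  (λ _ h<k → liars-unbalanced h<k , jacobi-unbalanced h<k) ,
  (λ h≡k → liars-balanced h≡k , jacobi-balanced h≡k)
  where open LiarCounts {N = N} carmichael primes odds unique Πps≡n lambda oddIndex v2
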